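{- Let $k$ be a field of characteristic zero, $A$ a countable set, $\diamond$ a commutative associative product on $kA$. For $f=c_1t+c_2t^2+\cdots\in tk[[t]]$ define $\Psi_f$ on $k\langle A\rangle$ as in the context. Let $\Sigma=\Psi_{t/(1-t)}$, $T=\Psi_{ -t}$, $\exp=\Psi_{e^t-1}$ and $\log=\Psi_{\log(1+t)}$. Then $\Sigma=\exp\circ T\circ\log\circ T$.
   Context: $k\langle A\rangle$ is the noncommutative polynomial algebra (words in letters of $A$); $\ell(w)$ is the length of a word $w$. For a composition $I=(i_1,\dots,i_m)$ of $n$ and a word $w=a_1\cdots a_n$, $I[w]=(a_1\diamond\cdots\diamond a_{i_1})(a_{i_1+1}\diamond\cdots\diamond a_{i_1+i_2})\cdots(a_{i_1+\dots+i_{m-1}+1}\diamond\cdots\diamond a_n)$ (concatenation of elements of $kA$, expanded linearly). For $f=\sum_{i\ge1}c_it^i$, $\Psi_f$ is the $k$-linear map with $\Psi_f(w)=\sum_{I=(i_1,\dots,i_m)} c_{i_1}\cdots c_{i_m}I[w]$, the sum over all compositions $I$ of $\ell(w)$ (and $\Psi_f(1)=1$). Thus $T(w)=(-1)^{\ell(w)}w$ and $\Sigma(w)=\sum_I I[w]$. -}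

module Defs where

open import Level using (Level; _⊔_)
open import Data.Nat as ℕ using (ℕ; zero; suc)
open import Data.Product using (_×_; _,_)
open import Data.List using (List; []; _∷_; [_]; length; take; drop; concatMap; map; foldl)
open import Data.List.Properties using (≡-dec)
open import Relation.Nullary using (¬_; yes; no; Dec)
open import Relation.Nullary.Decidable using (map′)
open import Relation.Binary.PropositionalEquality using (_≡_; cong)
open import Function.Bundles using (_↣_; Injection)
open import Algebra.Bundles using (CommutativeRing)

record Field (c ℓ : Level) : Set (Level.suc (c ⊔ ℓ)) where
  field
    commutativeRing : CommutativeRing c ℓ
  open CommutativeRing commutativeRing public
  field
    _⁻¹       : Carrier → Carrier
    0≉1       : ¬ (0# ≈ 1#)
    ⁻¹-inverse : ∀ x → ¬ (x ≈ 0#) → (x * (x ⁻¹)) ≈ 1#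

module _ {c ℓ : Level} (F : Field c ℓ) where
  open Field F

  natCast : ℕ → Carrier
  natCast zero    = 0#
  natCast (suc n) = 1# + natCast n

  CharZero : Set ℓ
  CharZero = ∀ n → ¬ (natCast (suc n) ≈ 0#)

decEqCountable : ∀ {a} {A : Set a} → A ↣ ℕ → (x y : A) → Dec (x ≡ y)
decEqCountable ι x y =
  map′ (Injection.injective ι) (cong (Injection.to ι)) (Injection.to ι x ℕ.≟ Injection.to ι y)

-- Compositions of n: lists of positive parts summing to n.
-- A composition of n+1 arises uniquely from one of n by either
-- prepending a part 1 or increasing the first part by 1.

compositions : ℕ → List (List ℕ)
compositions zero    = [ [] ]
compositions (suc n) = concatMap (λ I → (1 ∷ I) ∷ bump I) (compositions n)
  where
  bump : List ℕ → List (List ℕ)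
  bump []      = []
  bump (i ∷ I) = [ suc i ∷ I ]

-- The construction, for a field k, a countable alphabet A and a
-- bilinear product ⋄ on kA given on basis elements (a ⋄ b ∈ kA).

module Construction {c ℓ a : Level} (F : Field c ℓ) {A : Set a} (ι : A ↣ ℕ)
                    (_⋄_ : A → A → List (Field.Carrier F × A)) where
  open Field F

  KA : Set (c ⊔ a)
  KA = List (Carrier × A)

  Poly : Set (c ⊔ a)
  Poly = List (Carrier × List A)

  _≟A_ : (x y : A) → Dec (x ≡ y)
  _≟A_ = decEqCountable ι

  _≟W_ : (u v : List A) → Dec (u ≡ v)
  _≟W_ = ≡-dec _≟A_

  coeffKA : KA → A → Carrier
  coeffKA []            b = 0#
  coeffKA ((x , a′) ∷ p) b with a′ ≟A b
  ... | yes _ = x + coeffKA p b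
  ... | no  _ = coeffKA p b

  coeff : Poly → List A → Carrier
  coeff []            v = 0#
  coeff ((x , u) ∷ p) v with u ≟W v
  ... | yes _ = x + coeff p v
  ... | no  _ = coeff p v

  _≈KA_ : KA → KA → Set (a ⊔ ℓ)
  p ≈KA q = ∀ b → coeffKA p b ≈ coeffKA q b

  _≈P_ : Poly → Poly → Set (a ⊔ ℓ)
  p ≈P q = ∀ v → coeff p v ≈ coeff q v

  _⋄ₗ_ : KA → KA → KA
  p ⋄ₗ q = concatMap (λ { (x , a′) → concatMap (λ { (y , b) →
             map (λ { (z , d) → ((x * y) * z , d) }) (a′ ⋄ b) }) q }) p

  letter : A → KA
  letter b = [ (1# , b) ]

  Commutative⋄ : Set (a ⊔ ℓ)
  Commutative⋄ = ∀ x y → (x ⋄ y) ≈KA (y ⋄ x)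

  Associative⋄ : Set (a ⊔ ℓ)
  Associative⋄ = ∀ x y z → ((x ⋄ y) ⋄ₗ letter z) ≈KA (letter x ⋄ₗ (y ⋄ z))

  one : Poly
  one = [ (1# , []) ]

  scaleP : Carrier → Poly → Poly
  scaleP x = map (λ { (y , u) → (x * y , u) })

  _·_ : Poly → Poly → Poly
  p · q = concatMap (λ { (x , u) → map (λ { (y , v) → (x * y , u Data.List.++ v) }) q }) p

  embed : KA → Poly
  embed = map (λ { (x , b) → (x , [ b ]) })

  -- a₁ ⋄ ⋯ ⋄ aᵢ  (bracketed from the left; parts are nonempty)
  block : List A → KA
  block []      = []
  block (b ∷ w) = foldl (λ p d → p ⋄ₗ letter d) (letter b) w

  applyComp : List ℕ → List A → Poly
  applyComp []      w = one
  applyComp (i ∷ I) w = embed (block (take i w)) · applyComp I (drop i w)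

  -- a formal power series f = Σ c_i t^i is given by its coefficient sequence
  prodCoeffs : (ℕ → Carrier) → List ℕ → Carrier
  prodCoeffs f []      = 1#
  prodCoeffs f (i ∷ I) = f i * prodCoeffs f I

  -- Ψ_f on a word: Σ_I c_{i₁}⋯c_{iₘ} I[w] over compositions I of ℓ(w)
  Ψword : (ℕ → Carrier) → List A → Poly
  Ψword f w = concatMap (λ I → scaleP (prodCoeffs f I) (applyComp I w))
                        (compositions (length w))

  Ψ : (ℕ → Carrier) → Poly → Poly
  Ψ f = concatMap (λ { (x , w) → scaleP x (Ψword f w) })

  -- coefficient sequences of the series used
  -- t/(1-t) = Σ_{i≥1} t^i
  geomSeries : ℕ → Carrier
  geomSeries zero    = 0#
  geomSeries (suc _) = 1#

  minusT : ℕ → Carrier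
  minusT 1 = - 1#
  minusT _ = 0#

  factorial : ℕ → ℕ
  factorial zero    = 1
  factorial (suc n) = suc n ℕ.* factorial n

  expSeries : ℕ → Carrier
  expSeries zero    = 0#
  expSeries (suc n) = natCast F (factorial (suc n)) ⁻¹

  signPow : ℕ → Carrier
  signPow zero    = 1#
  signPow (suc n) = - signPow n

  logSeries : ℕ → Carrier
  logSeries zero    = 0#
  logSeries (suc n) = signPow n * (natCast F (suc n) ⁻¹)

  Σmap T expMap logMap : Poly → Poly
  Σmap   = Ψ geomSeries
  T      = Ψ minusT
  expMap = Ψ expSeries
  logMap = Ψ logSeries

module Submission where

-- The heart of the proof is a composition law: if ⋄ is associative then
-- Ψ_f ∘ Ψ_g = Ψ_{f∘g}, where f∘g is the composite power series (the
-- coefficients of f are applied to powers of g).  Since Σ, T, exp and log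
-- are Ψ_{t/(1-t)}, Ψ_{-t}, Ψ_{eᵗ-1} and Ψ_{log(1+t)}, the theorem reduces to
-- the identity of series  (eᵗ-1) ∘ (-t) ∘ log(1+t) ∘ (-t) = t/(1-t),  i.e.
-- e^{-log(1-t)} = 1/(1-t).

open import Defs
open import Level using (Level; _⊔_)
open import Data.Nat as ℕ using (ℕ; zero; suc; _≤_; _<_; z≤n; s≤s)
open import Data.Nat.Properties using (≤-refl; ≤-trans; m≤n⇒m≤1+n)
open import Data.Nat.Induction using (<-rec)
open import Data.Product using (_×_; _,_; proj₁; proj₂)
open import Data.List using (List; []; _∷_; [_]; concatMap; map; _++_; length; take; drop; foldl)
open import Data.List.Properties using (concatMap-cong)
import Data.List.Relation.Unary.All as All
open All using (All)
open import Data.Unit using (⊤; tt)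
open import Data.Empty using (⊥; ⊥-elim)
open import Relation.Nullary using (¬_; yes; no; Dec)
import Relation.Binary.PropositionalEquality as ≡
open ≡ using (_≡_)
import Relation.Binary.Reasoning.Setoid as SR
open import Function.Bundles using (_↣_)
open import Algebra.Bundles using (CommutativeRing)
import Algebra.Solver.Ring.NaturalCoefficients.Default as NC
-- Two combinations will be compared by testing them
-- against all functionals, which makes every manipulation of lists
-- (reordering, merging equal terms, ...) invisible.

module LinearCombinations {c ℓ} (R : CommutativeRing c ℓ) where
  open CommutativeRing R
  open SR setoid
  open NC commutativeSemiring using (solve; _:=_; _:+_; _:*_)

  Comb : ∀ {b} → Set b → Set (c ⊔ b)
  Comb B = List (Carrier × B)

  module _ {b} {B : Set b} where
    ev : (B → Carrier) → Comb B → Carrier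
    ev G []      = 0#
    ev G (t ∷ p) = proj₁ t * G (proj₂ t) + ev G p

    ev-++ : ∀ G p q → ev G (p ++ q) ≈ ev G p + ev G q
    ev-++ G []      q = sym (+-identityˡ _)
    ev-++ G (t ∷ p) q = trans (+-congˡ (ev-++ G p q)) (sym (+-assoc _ _ _))

    ev-cong : ∀ {G H : B → Carrier} → (∀ u → G u ≈ H u) → ∀ p → ev G p ≈ ev H p
    ev-cong e []      = refl
    ev-cong e (t ∷ p) = +-cong (*-congˡ (e (proj₂ t))) (ev-cong e p)

    ev-+ : ∀ (G H : B → Carrier) p → ev (λ u → G u + H u) p ≈ ev G p + ev H p
    ev-+ G H []      = sym (+-identityˡ _)
    ev-+ G H (t ∷ p) = begin
      proj₁ t * (G (proj₂ t) + H (proj₂ t)) + ev (λ u → G u + H u) p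
        ≈⟨ +-cong (distribˡ _ _ _) (ev-+ G H p) ⟩
      (proj₁ t * G (proj₂ t) + proj₁ t * H (proj₂ t)) + (ev G p + ev H p)
        ≈⟨ solve 4 (λ a b c d → (a :+ b) :+ (c :+ d) := (a :+ c) :+ (b :+ d)) refl _ _ _ _ ⟩
      (proj₁ t * G (proj₂ t) + ev G p) + (proj₁ t * H (proj₂ t) + ev H p) ∎

    ev-* : ∀ x (G : B → Carrier) p → ev (λ u → x * G u) p ≈ x * ev G p
    ev-* x G []      = sym (zeroʳ _)
    ev-* x G (t ∷ p) = begin
      proj₁ t * (x * G (proj₂ t)) + ev (λ u → x * G u) p ≈⟨ +-congˡ (ev-* x G p) ⟩
      proj₁ t * (x * G (proj₂ t)) + x * ev G p
        ≈⟨ solve 4 (λ a b c d → a :* (b :* c) :+ b :* d := b :* (a :* c :+ d)) refl _ _ _ _ ⟩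
      x * (proj₁ t * G (proj₂ t) + ev G p) ∎

    ev-0 : ∀ p → ev (λ (_ : B) → 0#) p ≈ 0#
    ev-0 []      = refl
    ev-0 (t ∷ p) = trans (+-cong (zeroʳ _) (ev-0 p)) (+-identityˡ _)

    ev-single : ∀ (G : B → Carrier) u → ev G [ (1# , u) ] ≈ G u
    ev-single G u = trans (+-identityʳ _) (*-identityˡ _)

    scale : Carrier → Comb B → Comb B
    scale x = map (λ t → (x * proj₁ t , proj₂ t))

  module _ {b b′} {B : Set b} {B′ : Set b′} where
    ev-rescale : ∀ (G : B′ → Carrier) x (k : B → B′) p →
      ev G (map (λ t → (x * proj₁ t , k (proj₂ t))) p) ≈ x * ev (λ u → G (k u)) p
    ev-rescale G x k []      = sym (zeroʳ _)
    ev-rescale G x k (t ∷ p) = begin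
      x * proj₁ t * G (k (proj₂ t)) + ev G (map (λ t → (x * proj₁ t , k (proj₂ t))) p)
        ≈⟨ +-congˡ (ev-rescale G x k p) ⟩
      x * proj₁ t * G (k (proj₂ t)) + x * ev (λ u → G (k u)) p
        ≈⟨ solve 4 (λ a b c d → a :* b :* c :+ a :* d := a :* (b :* c :+ d)) refl _ _ _ _ ⟩
      x * (proj₁ t * G (k (proj₂ t)) + ev (λ u → G (k u)) p) ∎

    ev-relabel : ∀ (G : B′ → Carrier) (k : B → B′) p →
      ev G (map (λ t → (proj₁ t , k (proj₂ t))) p) ≈ ev (λ u → G (k u)) p
    ev-relabel G k []      = refl
    ev-relabel G k (t ∷ p) = +-congˡ (ev-relabel G k p)

    ev-swap : ∀ (H : B → B′ → Carrier) p q →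
      ev (λ u → ev (H u) q) p ≈ ev (λ v → ev (λ u → H u v) p) q
    ev-swap H []      q = sym (ev-0 q)
    ev-swap H (t ∷ p) q = begin
      proj₁ t * ev (H (proj₂ t)) q + ev (λ u → ev (H u) q) p
        ≈⟨ +-cong (sym (ev-* (proj₁ t) (H (proj₂ t)) q)) (ev-swap H p q) ⟩
      ev (λ v → proj₁ t * H (proj₂ t) v) q + ev (λ v → ev (λ u → H u v) p) q
        ≈⟨ sym (ev-+ _ _ q) ⟩
      ev (λ v → proj₁ t * H (proj₂ t) v + ev (λ u → H u v) p) q ∎

  module _ {b b′} {B : Set b} {B′ : Set b′} where
    linExt : (B → Comb B′) → Comb B → Comb B′
    linExt φ = concatMap (λ t → scale (proj₁ t) (φ (proj₂ t)))

    ev-linExt : ∀ (G : B′ → Carrier) φ p → ev G (linExt φ p) ≈ ev (λ u → ev G (φ u)) p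
    ev-linExt G φ []      = refl
    ev-linExt G φ (t ∷ p) = begin
      ev G (scale (proj₁ t) (φ (proj₂ t)) ++ linExt φ p)
        ≈⟨ ev-++ G (scale (proj₁ t) (φ (proj₂ t))) (linExt φ p) ⟩
      ev G (scale (proj₁ t) (φ (proj₂ t))) + ev G (linExt φ p)
        ≈⟨ +-cong (ev-rescale G (proj₁ t) (λ u → u) (φ (proj₂ t))) (ev-linExt G φ p) ⟩
      proj₁ t * ev G (φ (proj₂ t)) + ev (λ u → ev G (φ u)) p ∎

module PowerSeries {c ℓ} (R : CommutativeRing c ℓ) where
  open CommutativeRing R
  open SR setoid
  open NC commutativeSemiring using (solve; _:=_; _:+_; _:*_; con)
  open import Algebra.Properties.Semiring.Mult semiring using () renaming (_×_ to _×ᵣ_)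

  Seq : Set c
  Seq = ℕ → Carrier

  shift : Seq → Seq
  shift a i = a (suc i)

  N : ℕ → Carrier
  N n = n ×ᵣ 1#

  conv : ℕ → Seq → Seq → Carrier
  conv zero    a b = a 0 * b 0
  conv (suc n) a b = a 0 * b (suc n) + conv n (shift a) b

  conv-cong₁ : ∀ n {a a′ b} → (∀ i → a i ≈ a′ i) → conv n a b ≈ conv n a′ b
  conv-cong₁ zero    e = *-congʳ (e 0)
  conv-cong₁ (suc n) e = +-cong (*-congʳ (e 0)) (conv-cong₁ n (λ i → e (suc i)))

  conv-cong₂ : ∀ n a {b b′} → (∀ j → j ≤ n → b j ≈ b′ j) → conv n a b ≈ conv n a b′
  conv-cong₂ zero    a e = *-congˡ (e 0 z≤n)
  conv-cong₂ (suc n) a e =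
    +-cong (*-congˡ (e (suc n) ≤-refl)) (conv-cong₂ n (shift a) (λ j j≤n → e j (m≤n⇒m≤1+n j≤n)))

  conv-+₁ : ∀ n a a′ b → conv n (λ i → a i + a′ i) b ≈ conv n a b + conv n a′ b
  conv-+₁ zero    a a′ b = distribʳ _ _ _
  conv-+₁ (suc n) a a′ b = begin
    (a 0 + a′ 0) * b (suc n) + conv n (λ i → a (suc i) + a′ (suc i)) b
      ≈⟨ +-cong (distribʳ _ _ _) (conv-+₁ n (shift a) (shift a′) b) ⟩
    (a 0 * b (suc n) + a′ 0 * b (suc n)) + (conv n (shift a) b + conv n (shift a′) b)
      ≈⟨ solve 4 (λ a b c d → (a :+ b) :+ (c :+ d) := (a :+ c) :+ (b :+ d)) refl _ _ _ _ ⟩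
    conv (suc n) a b + conv (suc n) a′ b ∎

  conv-+₂ : ∀ n a b b′ → conv n a (λ j → b j + b′ j) ≈ conv n a b + conv n a b′
  conv-+₂ zero    a b b′ = distribˡ _ _ _
  conv-+₂ (suc n) a b b′ = begin
    a 0 * (b (suc n) + b′ (suc n)) + conv n (shift a) (λ j → b j + b′ j)
      ≈⟨ +-cong (distribˡ _ _ _) (conv-+₂ n (shift a) b b′) ⟩
    (a 0 * b (suc n) + a 0 * b′ (suc n)) + (conv n (shift a) b + conv n (shift a) b′)
      ≈⟨ solve 4 (λ a b c d → (a :+ b) :+ (c :+ d) := (a :+ c) :+ (b :+ d)) refl _ _ _ _ ⟩
    conv (suc n) a b + conv (suc n) a b′ ∎

  conv-last : ∀ n a b → conv (suc n) a b ≈ conv n a (shift b) + a (suc n) * b 0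
  conv-last zero    a b = refl
  conv-last (suc n) a b = begin
    a 0 * b (suc (suc n)) + conv (suc n) (shift a) b
      ≈⟨ +-congˡ (conv-last n (shift a) b) ⟩
    a 0 * b (suc (suc n)) + (conv n (shift a) (shift b) + a (suc (suc n)) * b 0)
      ≈⟨ sym (+-assoc _ _ _) ⟩
    conv (suc n) a (shift b) + a (suc (suc n)) * b 0 ∎

  conv-comm : ∀ n a b → conv n a b ≈ conv n b a
  conv-comm zero    a b = *-comm _ _
  conv-comm (suc n) a b = begin
    a 0 * b (suc n) + conv n (shift a) b ≈⟨ +-cong (*-comm _ _) (conv-comm n (shift a) b) ⟩
    b (suc n) * a 0 + conv n b (shift a) ≈⟨ +-comm _ _ ⟩
    conv n b (shift a) + b (suc n) * a 0 ≈⟨ sym (conv-last n b a) ⟩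
    conv (suc n) b a                     ∎

  -- partial sums  Σ_{j ≤ n} Y j  (the coefficients of Y/(1-t))
  ones : Seq
  ones _ = 1#

  psum : ℕ → Seq → Carrier
  psum n Y = conv n ones Y

  psum-ones : ∀ n → psum n ones ≈ N (suc n)
  psum-ones zero    = trans (*-identityˡ _) (sym (+-identityʳ _))
  psum-ones (suc n) = +-cong (*-identityˡ _) (psum-ones n)

  psum-suc : ∀ n V → psum (suc n) V ≈ V 0 + psum n (shift V)
  psum-suc zero    V = trans (+-comm _ _) (+-congʳ (*-identityˡ _))
  psum-suc (suc n) V = begin
    1# * V (suc (suc n)) + psum (suc n) V            ≈⟨ +-congˡ (psum-suc n V) ⟩
    1# * V (suc (suc n)) + (V 0 + psum n (shift V))
      ≈⟨ solve 3 (λ a b c → a :+ (b :+ c) := b :+ (a :+ c)) refl _ _ _ ⟩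
    V 0 + psum (suc n) (shift V)                     ∎

  -- associativity of the triple product (1/(1-t))·Y·a, in coefficients
  conv-psum : ∀ n Y a → conv n (λ j → psum j Y) a ≈ psum n (λ q → conv q Y a)
  conv-psum zero    Y a = solve 3 (λ u y a → (u :* y) :* a := u :* (y :* a)) refl 1# (Y 0) (a 0)
  conv-psum (suc n) Y a = begin
    psum 0 Y * a (suc n) + conv n (λ j → 1# * Y (suc j) + psum j Y) a
      ≈⟨ +-congˡ (conv-+₁ n (λ j → 1# * Y (suc j)) (λ j → psum j Y) a) ⟩
    psum 0 Y * a (suc n) + (conv n (λ j → 1# * Y (suc j)) a + conv n (λ j → psum j Y) a)
      ≈⟨ +-cong (*-congʳ (*-identityˡ _)) (+-cong (conv-cong₁ n (λ j → *-identityˡ _)) (conv-psum n Y a)) ⟩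
    Y 0 * a (suc n) + (conv n (shift Y) a + psum n (λ q → conv q Y a))
      ≈⟨ sym (trans (+-congʳ (*-identityˡ _)) (+-assoc _ _ _)) ⟩
    1# * conv (suc n) Y a + psum n (λ q → conv q Y a) ∎

  -- multiplication by t, applied to Y/(1-t) and to a·Y
  shiftPsum : Seq → Seq
  shiftPsum Y zero    = 0#
  shiftPsum Y (suc p) = psum p Y

  shiftConv : Seq → Seq → Seq
  shiftConv a Y zero    = 0#
  shiftConv a Y (suc q) = conv q a Y

  conv-shiftPsum : ∀ n a Y → conv n a (shiftPsum Y) ≈ psum n (shiftConv a Y)
  conv-shiftPsum zero    a Y = trans (zeroʳ _) (sym (zeroʳ _))
  conv-shiftPsum (suc n) a Y = begin
    conv (suc n) a (shiftPsum Y)                ≈⟨ conv-comm (suc n) a (shiftPsum Y) ⟩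
    0# * a (suc n) + conv n (λ j → psum j Y) a  ≈⟨ trans (+-congʳ (zeroˡ _)) (+-identityˡ _) ⟩
    conv n (λ j → psum j Y) a                   ≈⟨ conv-psum n Y a ⟩
    psum n (λ q → conv q Y a)                   ≈⟨ conv-cong₂ n ones (λ j _ → conv-comm j Y a) ⟩
    psum n (λ q → conv q a Y)                   ≈⟨ sym (+-identityˡ _) ⟩
    0# + psum n (shift (shiftConv a Y))         ≈⟨ sym (psum-suc n (shiftConv a Y)) ⟩
    psum (suc n) (shiftConv a Y)                ∎

  -- Leibniz rule for the derivative  D a (i) = (i+1)·a(i+1), read off at the
  -- coefficient of tⁿ: (n+1)·Σ_{i+j=n} aᵢYⱼ = Σ (i+1)aᵢYⱼ + Σ aᵢ·jYⱼ
  leibniz : ∀ n a Y → N (suc n) * conv n a Y ≈ conv n (λ i → N (suc i) * a i) Y + conv n a (λ j → N j * Y j)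
  leibniz zero a Y = begin
    N 1 * (a 0 * Y 0)                       ≈⟨ sym (*-assoc _ _ _) ⟩
    (N 1 * a 0) * Y 0                       ≈⟨ sym (+-identityʳ _) ⟩
    (N 1 * a 0) * Y 0 + 0#                  ≈⟨ +-congˡ (sym (trans (*-congˡ (zeroˡ _)) (zeroʳ _))) ⟩
    (N 1 * a 0) * Y 0 + a 0 * (0# * Y 0)    ∎
  leibniz (suc n) a Y = begin
    (1# + N (suc n)) * (a 0 * Y (suc n) + conv n a′ Y)
      ≈⟨ solve 3 (λ m x c → (con 1 :+ m) :* (x :+ c) := x :+ (c :+ (m :* x :+ m :* c)))
               refl (N (suc n)) (a 0 * Y (suc n)) (conv n a′ Y) ⟩
    a 0 * Y (suc n) + (conv n a′ Y + (N (suc n) * (a 0 * Y (suc n)) + N (suc n) * conv n a′ Y))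
      ≈⟨ +-congˡ (+-congˡ (+-congˡ (leibniz n a′ Y))) ⟩
    a 0 * Y (suc n) + (conv n a′ Y + (N (suc n) * (a 0 * Y (suc n)) + (conv n (λ i → N (suc i) * a′ i) Y + conv n a′ Yw)))
      ≈⟨ solve 6 (λ m a y c d e → a :* y :+ (c :+ (m :* (a :* y) :+ (d :+ e)))
                                   := ((con 1 :* a) :* y :+ (c :+ d)) :+ (a :* (m :* y) :+ e))
               refl (N (suc n)) (a 0) (Y (suc n)) (conv n a′ Y) (conv n (λ i → N (suc i) * a′ i) Y) (conv n a′ Yw) ⟩
    ((1# * a 0) * Y (suc n) + (conv n a′ Y + conv n (λ i → N (suc i) * a′ i) Y)) + (a 0 * (N (suc n) * Y (suc n)) + conv n a′ Yw)
      ≈⟨ +-congʳ (+-cong (*-congʳ (*-congʳ (sym (+-identityʳ 1#)))) (sym split)) ⟩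
    conv (suc n) (λ i → N (suc i) * a i) Y + conv (suc n) a Yw ∎
    where
    a′ = shift a
    Yw = λ j → N j * Y j
    split : conv n (λ i → N (suc (suc i)) * a′ i) Y ≈ conv n a′ Y + conv n (λ i → N (suc i) * a′ i) Y
    split = trans (conv-cong₁ n (λ i → distribʳ _ _ _))
                  (trans (conv-+₁ n (λ i → 1# * a′ i) (λ i → N (suc i) * a′ i) Y)
                         (+-congʳ (conv-cong₁ n (λ i → *-identityˡ _))))

  -- compWith g F G  are the coefficients of  G(t) · F(g(t)),  where
  -- F(u) = Σ Fᵢ uⁱ and g is read without its constant term.  Writing
  -- F(u) = F₀ + u·F₁(u), g = t·γ(t) and G = G₀ + t·G₁(t) gives the recursion.
  compWith : Seq → Seq → Seq → Seq
  compWith g F G zero    = G 0 * F 0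
  compWith g F G (suc k) = G 0 * compWith g (shift F) (shift g) k + compWith g F (shift G) k

  compose : Seq → Seq → Seq
  compose f g zero    = f 0
  compose f g (suc k) = compWith g (shift f) (shift g) k

  compWith-cong : ∀ {g g′} → (∀ n → g n ≈ g′ n) → ∀ k {F F′ G G′} →
    (∀ j → F j ≈ F′ j) → (∀ j → G j ≈ G′ j) → compWith g F G k ≈ compWith g′ F′ G′ k
  compWith-cong eg zero    eF eG = *-cong (eG 0) (eF 0)
  compWith-cong eg (suc k) eF eG =
    +-cong (*-cong (eG 0) (compWith-cong eg k (λ j → eF (suc j)) (λ j → eg (suc j))))
           (compWith-cong eg k eF (λ j → eG (suc j)))

  compose-cong : ∀ {f f′ g g′} → (∀ n → f n ≈ f′ n) → (∀ n → g n ≈ g′ n) → ∀ k → compose f g k ≈ compose f′ g′ k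
  compose-cong ef eg zero    = ef 0
  compose-cong ef eg (suc k) = compWith-cong eg k (λ j → ef (suc j)) (λ j → eg (suc j))

  compWith-zeroG : ∀ g F k → compWith g F (λ _ → 0#) k ≈ 0#
  compWith-zeroG g F zero    = zeroˡ _
  compWith-zeroG g F (suc k) = trans (+-cong (zeroˡ _) (compWith-zeroG g F k)) (+-identityˡ _)

  compWith-zeroF : ∀ g {F} G k → (∀ j → F j ≈ 0#) → compWith g F G k ≈ 0#
  compWith-zeroF g G zero    eF = trans (*-congˡ (eF 0)) (zeroʳ _)
  compWith-zeroF g G (suc k) eF =
    trans (+-cong (trans (*-congˡ (compWith-zeroF g (shift g) k (λ j → eF (suc j)))) (zeroʳ _))
                  (compWith-zeroF g (shift G) k eF))
          (+-identityˡ _)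

  compWith-const : ∀ g {F} G k → (∀ j → F (suc j) ≈ 0#) → compWith g F G k ≈ F 0 * G k
  compWith-const g G zero    eF = *-comm _ _
  compWith-const g {F} G (suc k) eF = begin
    G 0 * compWith g (shift F) (shift g) k + compWith g F (shift G) k
      ≈⟨ +-cong (*-congˡ (compWith-zeroF g (shift g) k eF)) (compWith-const g (shift G) k eF) ⟩
    G 0 * 0# + F 0 * G (suc k)  ≈⟨ trans (+-congʳ (zeroʳ _)) (+-identityˡ _) ⟩
    F 0 * G (suc k)             ∎

  compWith-+ : ∀ g k F₁ F₂ G → compWith g (λ j → F₁ j + F₂ j) G k ≈ compWith g F₁ G k + compWith g F₂ G k
  compWith-+ g zero    F₁ F₂ G = distribˡ _ _ _
  compWith-+ g (suc k) F₁ F₂ G = begin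
    G 0 * compWith g (λ j → F₁ (suc j) + F₂ (suc j)) (shift g) k + compWith g (λ j → F₁ j + F₂ j) (shift G) k
      ≈⟨ +-cong (*-congˡ (compWith-+ g k (shift F₁) (shift F₂) (shift g))) (compWith-+ g k F₁ F₂ (shift G)) ⟩
    G 0 * (compWith g (shift F₁) (shift g) k + compWith g (shift F₂) (shift g) k)
      + (compWith g F₁ (shift G) k + compWith g F₂ (shift G) k)
      ≈⟨ solve 5 (λ g a₁ a₂ b₁ b₂ → g :* (a₁ :+ a₂) :+ (b₁ :+ b₂) := (g :* a₁ :+ b₁) :+ (g :* a₂ :+ b₂)) refl (G 0) _ _ _ _ ⟩
    compWith g F₁ G (suc k) + compWith g F₂ G (suc k) ∎

  compose-+ : ∀ g k F₁ F₂ → compose (λ j → F₁ j + F₂ j) g k ≈ compose F₁ g k + compose F₂ g k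
  compose-+ g zero    F₁ F₂ = refl
  compose-+ g (suc k) F₁ F₂ = compWith-+ g k (shift F₁) (shift F₂) (shift g)

  compWith-conv : ∀ g k F G → compWith g F G k ≈ conv k G (compose F g)
  compWith-conv g zero    F G = refl
  compWith-conv g (suc k) F G = +-congˡ (compWith-conv g k F (shift G))

  compose-suc : ∀ F g n → compose F g (suc n) ≈ conv n (shift g) (compose (shift F) g)
  compose-suc F g n = compWith-conv g n (shift F) (shift g)

  deriv : Seq → Seq
  deriv F m = N (suc m) * F (suc m)

  -- Chain rule for composing with a series L whose derivative is 1/(1-t):
  -- D(F(L)) = (DF)(L) · D L = (DF)(L)/(1-t).  It is proved for all F at once
  -- by strong induction on the degree, since F(L) = F₀ + L·F₁(L) refers to
  -- the shifted series F₁.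
  module ChainRule (L : Seq) (DL≈1 : ∀ i → N (suc i) * L (suc i) ≈ 1#) where

    ChainAt : ℕ → Set (c ⊔ ℓ)
    ChainAt n = ∀ F → N (suc n) * compose F L (suc n) ≈ psum n (compose (deriv F) L)

    chain-step : ∀ n → (∀ {p} → p < n → ChainAt p) → ChainAt n
    chain-step n IH F = begin
      N (suc n) * compose F L (suc n)      ≈⟨ *-congˡ (compose-suc F L n) ⟩
      N (suc n) * conv n L₁ Z              ≈⟨ leibniz n L₁ Z ⟩
      conv n (λ i → N (suc i) * L₁ i) Z + conv n L₁ (λ j → N j * Z j)
        ≈⟨ +-cong (conv-cong₁ n DL≈1) (conv-cong₂ n L₁ weighted) ⟩
      psum n Z + conv n L₁ (shiftPsum (compose (deriv F₁) L))
        ≈⟨ +-congˡ (conv-shiftPsum n L₁ (compose (deriv F₁) L)) ⟩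
      psum n Z + psum n (shiftConv L₁ (compose (deriv F₁) L))
        ≈⟨ +-congˡ (conv-cong₂ n ones tail) ⟩
      psum n Z + psum n (compose H L)      ≈⟨ sym (conv-+₂ n ones Z (compose H L)) ⟩
      psum n (λ j → Z j + compose H L j)
        ≈⟨ conv-cong₂ n ones (λ j _ → trans (sym (compose-+ L j F₁ H)) (compose-cong sum (λ _ → refl) j)) ⟩
      psum n (compose (deriv F) L) ∎
      where
      L₁ = shift L
      F₁ = shift F
      Z  = compose F₁ L
      -- H = t·D(F₁), so that DF = F₁ + H
      H : Seq
      H m = N m * F (suc m)
      weighted : ∀ j → j ≤ n → N j * Z j ≈ shiftPsum (compose (deriv F₁) L) j
      weighted zero    _    = zeroˡ _
      weighted (suc p) p<n = IH p<n F₁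
      tail : ∀ j → j ≤ n → shiftConv L₁ (compose (deriv F₁) L) j ≈ compose H L j
      tail zero    _ = sym (zeroˡ _)
      tail (suc q) _ = sym (compose-suc H L q)
      sum : ∀ m → F₁ m + H m ≈ deriv F m
      sum m = solve 2 (λ f m → f :+ m :* f := (con 1 :+ m) :* f) refl (F (suc m)) (N m)

    chain-rule : ∀ n → ChainAt n
    chain-rule = <-rec ChainAt chain-step

    exp∘L≈geometric : (∀ k {x y} → N (suc k) * x ≈ N (suc k) * y → x ≈ y) →
                      ∀ E → E 0 ≈ 1# → (∀ m → deriv E m ≈ E m) → ∀ k → compose E L k ≈ 1#
    exp∘L≈geometric cancel E E₀≈1 DE≈E = <-rec (λ k → compose E L k ≈ 1#) step
      where
      step : ∀ k → (∀ {j} → j < k → compose E L j ≈ 1#) → compose E L k ≈ 1#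
      step zero    _  = E₀≈1
      step (suc k) IH = cancel k (begin
        N (suc k) * compose E L (suc k) ≈⟨ chain-rule k E ⟩
        psum k (compose (deriv E) L)    ≈⟨ conv-cong₂ k ones (λ j _ → compose-cong DE≈E (λ _ → refl) j) ⟩
        psum k (compose E L)            ≈⟨ conv-cong₂ k ones (λ j j≤k → IH (s≤s j≤k)) ⟩
        psum k ones                     ≈⟨ psum-ones k ⟩
        N (suc k)                       ≈⟨ sym (*-identityʳ _) ⟩
        N (suc k) * 1#                  ∎)

module CharZeroField {c ℓ} (F : Field c ℓ) (cz : CharZero F) where
  open Field F
  open SR setoid
  open NC commutativeSemiring using (solve; _:=_; _:*_)
  open PowerSeries commutativeRing

  natCast≈N : ∀ n → natCast F n ≈ N n
  natCast≈N zero    = refl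
  natCast≈N (suc n) = +-congˡ (natCast≈N n)

  nonzero-* : ∀ {x y} → ¬ (x ≈ 0#) → ¬ (y ≈ 0#) → ¬ (x * y ≈ 0#)
  nonzero-* {x} {y} x≉0 y≉0 xy≈0 = x≉0 (begin
    x                ≈⟨ sym (*-identityʳ x) ⟩
    x * 1#           ≈⟨ *-congˡ (sym (⁻¹-inverse y y≉0)) ⟩
    x * (y * y ⁻¹)   ≈⟨ sym (*-assoc _ _ _) ⟩
    (x * y) * y ⁻¹   ≈⟨ *-congʳ xy≈0 ⟩
    0# * y ⁻¹        ≈⟨ zeroˡ _ ⟩
    0#               ∎)

  cancelˡ : ∀ {x u v} → ¬ (x ≈ 0#) → x * u ≈ x * v → u ≈ v
  cancelˡ {x} {u} {v} x≉0 e = begin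
    u                ≈⟨ sym (*-identityˡ u) ⟩
    1# * u           ≈⟨ *-congʳ (sym x⁻¹x≈1) ⟩
    (x ⁻¹ * x) * u   ≈⟨ *-assoc _ _ _ ⟩
    x ⁻¹ * (x * u)   ≈⟨ *-congˡ e ⟩
    x ⁻¹ * (x * v)   ≈⟨ sym (*-assoc _ _ _) ⟩
    (x ⁻¹ * x) * v   ≈⟨ *-congʳ x⁻¹x≈1 ⟩
    1# * v           ≈⟨ *-identityˡ v ⟩
    v                ∎
    where
    x⁻¹x≈1 : x ⁻¹ * x ≈ 1#
    x⁻¹x≈1 = trans (*-comm _ _) (⁻¹-inverse x x≉0)

  inverse-unique : ∀ {x z} → ¬ (x ≈ 0#) → x * z ≈ 1# → z ≈ x ⁻¹
  inverse-unique x≉0 xz≈1 = cancelˡ x≉0 (trans xz≈1 (sym (⁻¹-inverse _ x≉0)))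

  ⁻¹-cong : ∀ {x y} → ¬ (x ≈ 0#) → ¬ (y ≈ 0#) → x ≈ y → x ⁻¹ ≈ y ⁻¹
  ⁻¹-cong x≉0 y≉0 x≈y = sym (inverse-unique x≉0 (trans (*-congʳ x≈y) (⁻¹-inverse _ y≉0)))

  ⁻¹-* : ∀ {x y} → ¬ (x ≈ 0#) → ¬ (y ≈ 0#) → (x * y) ⁻¹ ≈ x ⁻¹ * y ⁻¹
  ⁻¹-* {x} {y} x≉0 y≉0 = sym (inverse-unique (nonzero-* x≉0 y≉0) (begin
    (x * y) * (x ⁻¹ * y ⁻¹)
      ≈⟨ solve 4 (λ x y a b → (x :* y) :* (a :* b) := (x :* a) :* (y :* b)) refl x y (x ⁻¹) (y ⁻¹) ⟩
    (x * x ⁻¹) * (y * y ⁻¹) ≈⟨ *-cong (⁻¹-inverse x x≉0) (⁻¹-inverse y y≉0) ⟩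
    1# * 1#                 ≈⟨ *-identityˡ 1# ⟩
    1#                      ∎))

  -- coefficients of -log(1-t)
  logGeometric : Seq
  logGeometric zero    = 0#
  logGeometric (suc n) = natCast F (suc n) ⁻¹

  D-logGeometric : ∀ i → N (suc i) * logGeometric (suc i) ≈ 1#
  D-logGeometric i = trans (*-congʳ (sym (natCast≈N (suc i)))) (⁻¹-inverse _ (cz i))

  exp∘logGeometric : ∀ E → E 0 ≈ 1# → (∀ m → deriv E m ≈ E m) → ∀ k → compose E logGeometric k ≈ 1#
  exp∘logGeometric = exp∘L≈geometric cancel
    where
    open ChainRule logGeometric D-logGeometric
    cancel : ∀ k {x y} → N (suc k) * x ≈ N (suc k) * y → x ≈ y
    cancel k e = cancelˡ (λ N≈0 → cz k (trans (natCast≈N (suc k)) N≈0)) e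

-- Throughout, two polynomials are compared by
-- their pairings with all functionals G : A* → k (relation ∼); at the end this
-- is converted back to equality of coefficients by pairing with the
-- indicator functional of a word.

module Operators {c ℓ a} (F : Field c ℓ) {A : Set a} (ι : A ↣ ℕ)
                 (_⋄_ : A → A → List (Field.Carrier F × A)) where
  open Field F
  open Construction F ι _⋄_
  open LinearCombinations commutativeRing
  open PowerSeries commutativeRing using (Seq; shift; compWith; compose)
  open SR setoid
  open NC commutativeSemiring using (solve; _:=_; _:+_; _:*_)
  open import Algebra.Properties.Ring ring using (-1*x≈-x; x∙y⁻¹≈ε⇒x≈y)

  _∼_ : Poly → Poly → Set (a ⊔ c ⊔ ℓ)
  p ∼ q = ∀ (G : List A → Carrier) → ev G p ≈ ev G q

  _∼K_ : KA → KA → Set (a ⊔ c ⊔ ℓ)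
  p ∼K q = ∀ (G : A → Carrier) → ev G p ≈ ev G q

  infix 4 _∼_ _∼K_

  indicator : List A → List A → Carrier
  indicator v u with u ≟W v
  ... | yes _ = 1#
  ... | no  _ = 0#

  coeff≈ev-indicator : ∀ p v → coeff p v ≈ ev (indicator v) p
  coeff≈ev-indicator []            v = refl
  coeff≈ev-indicator ((x , u) ∷ p) v with u ≟W v
  ... | yes _ = +-cong (sym (*-identityʳ x)) (coeff≈ev-indicator p v)
  ... | no  _ = trans (coeff≈ev-indicator p v) (sym (trans (+-congʳ (zeroʳ x)) (+-identityˡ _)))

  ∼⇒≈P : ∀ {p q} → p ∼ q → p ≈P q
  ∼⇒≈P {p} {q} p∼q v = trans (coeff≈ev-indicator p v) (trans (p∼q (indicator v)) (sym (coeff≈ev-indicator q v)))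

  ev-scaleP : ∀ (G : List A → Carrier) x p → ev G (scaleP x p) ≈ x * ev G p
  ev-scaleP G x p = ev-rescale G x (λ u → u) p

  ev-· : ∀ (G : List A → Carrier) p q → ev G (p · q) ≈ ev (λ u → ev (λ v → G (u ++ v)) q) p
  ev-· G []      q = refl
  ev-· G (t ∷ p) q = begin
    ev G (map (λ s → (proj₁ t * proj₁ s , proj₂ t ++ proj₂ s)) q ++ p · q)
      ≈⟨ ev-++ G (map (λ s → (proj₁ t * proj₁ s , proj₂ t ++ proj₂ s)) q) (p · q) ⟩
    _ ≈⟨ +-cong (ev-rescale G (proj₁ t) (proj₂ t ++_) q) (ev-· G p q) ⟩
    proj₁ t * ev (λ v → G (proj₂ t ++ v)) q + ev (λ u → ev (λ v → G (u ++ v)) q) p ∎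

  ev-embed· : ∀ (G : List A → Carrier) b Q → ev G (embed b · Q) ≈ ev (λ d → ev (λ v → G (d ∷ v)) Q) b
  ev-embed· G b Q = trans (ev-· G (embed b) Q) (ev-relabel (λ u → ev (λ v → G (u ++ v)) Q) [_] b)

  ev-letter· : ∀ (G : List A → Carrier) d Q → ev G (embed (letter d) · Q) ≈ ev (λ v → G (d ∷ v)) Q
  ev-letter· G d Q = trans (ev-embed· G (letter d) Q) (ev-single (λ d′ → ev (λ v → G (d′ ∷ v)) Q) d)

  ∼-·ʳ : ∀ p {q q′} → q ∼ q′ → p · q ∼ p · q′
  ∼-·ʳ p {q} {q′} q∼q′ G =
    trans (ev-· G p q) (trans (ev-cong (λ u → q∼q′ (λ v → G (u ++ v))) p) (sym (ev-· G p q′)))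

  ∼-linExt : ∀ (φ : List A → Poly) {p q} → p ∼ q → linExt φ p ∼ linExt φ q
  ∼-linExt φ {p} {q} p∼q G = trans (ev-linExt G φ p) (trans (p∼q (λ u → ev G (φ u))) (sym (ev-linExt G φ q)))

  ∼-linExt-pointwise : ∀ {φ ψ : List A → Poly} → (∀ w → φ w ∼ ψ w) → ∀ p → linExt φ p ∼ linExt ψ p
  ∼-linExt-pointwise {φ} {ψ} φ∼ψ p G =
    trans (ev-linExt G φ p) (trans (ev-cong (λ w → φ∼ψ w G) p) (sym (ev-linExt G ψ p)))

  ev-linExt-scale : ∀ (G : List A → Carrier) φ x P → ev G (linExt φ (scaleP x P)) ≈ x * ev G (linExt φ P)
  ev-linExt-scale G φ x P = begin
    ev G (linExt φ (scaleP x P))        ≈⟨ ev-linExt G φ (scaleP x P) ⟩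
    ev (λ u → ev G (φ u)) (scaleP x P)  ≈⟨ ev-scaleP (λ u → ev G (φ u)) x P ⟩
    x * ev (λ u → ev G (φ u)) P         ≈⟨ *-congˡ (sym (ev-linExt G φ P)) ⟩
    x * ev G (linExt φ P)               ∎

  ev-linExt-scale-++ : ∀ (G : List A → Carrier) φ x P R →
    ev G (linExt φ (scaleP x P ++ R)) ≈ x * ev G (linExt φ P) + ev G (linExt φ R)
  ev-linExt-scale-++ G φ x P R = begin
    ev G (linExt φ (scaleP x P ++ R))                         ≈⟨ ev-linExt G φ (scaleP x P ++ R) ⟩
    ev (λ u → ev G (φ u)) (scaleP x P ++ R)                   ≈⟨ ev-++ (λ u → ev G (φ u)) (scaleP x P) R ⟩
    ev (λ u → ev G (φ u)) (scaleP x P) + ev (λ u → ev G (φ u)) R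
      ≈⟨ +-cong (trans (sym (ev-linExt G φ (scaleP x P))) (ev-linExt-scale G φ x P)) (sym (ev-linExt G φ R)) ⟩
    x * ev G (linExt φ P) + ev G (linExt φ R)                 ∎

  linExt-linExt : ∀ (φ ψ : List A → Poly) P → linExt φ (linExt ψ P) ∼ linExt (λ w → linExt φ (ψ w)) P
  linExt-linExt φ ψ P L = begin
    ev L (linExt φ (linExt ψ P))                    ≈⟨ ev-linExt L φ (linExt ψ P) ⟩
    ev (λ u → ev L (φ u)) (linExt ψ P)              ≈⟨ ev-linExt (λ u → ev L (φ u)) ψ P ⟩
    ev (λ w → ev (λ u → ev L (φ u)) (ψ w)) P        ≈⟨ ev-cong (λ w → sym (ev-linExt L φ (ψ w))) P ⟩
    ev (λ w → ev L (linExt φ (ψ w))) P              ≈⟨ sym (ev-linExt L (λ w → linExt φ (ψ w)) P) ⟩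
    ev L (linExt (λ w → linExt φ (ψ w)) P)          ∎

  ev-⋄ : ∀ (G : A → Carrier) p q → ev G (p ⋄ₗ q) ≈ ev (λ a → ev (λ b → ev G (a ⋄ b)) q) p
  ev-⋄ G []      q = refl
  ev-⋄ G (t ∷ p) q = trans (ev-++ G (row (proj₁ t) (proj₂ t) q) (p ⋄ₗ q))
                           (+-cong (ev-row (proj₁ t) (proj₂ t) q) (ev-⋄ G p q))
    where
    row : Carrier → A → KA → KA
    row x a q = concatMap (λ yb → map (λ zd → ((x * proj₁ yb) * proj₁ zd , proj₂ zd)) (a ⋄ proj₂ yb)) q
    ev-row : ∀ x a q → ev G (row x a q) ≈ x * ev (λ b → ev G (a ⋄ b)) q
    ev-row x a []      = sym (zeroʳ _)
    ev-row x a (s ∷ q) = begin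
      ev G (map (λ zd → ((x * proj₁ s) * proj₁ zd , proj₂ zd)) (a ⋄ proj₂ s) ++ row x a q)
        ≈⟨ ev-++ G (map (λ zd → ((x * proj₁ s) * proj₁ zd , proj₂ zd)) (a ⋄ proj₂ s)) (row x a q) ⟩
      _ ≈⟨ +-cong (ev-rescale G (x * proj₁ s) (λ u → u) (a ⋄ proj₂ s)) (ev-row x a q) ⟩
      (x * proj₁ s) * ev G (a ⋄ proj₂ s) + x * ev (λ b → ev G (a ⋄ b)) q
        ≈⟨ solve 4 (λ a b c d → a :* b :* c :+ a :* d := a :* (b :* c :+ d)) refl _ _ _ _ ⟩
      x * (proj₁ s * ev G (a ⋄ proj₂ s) + ev (λ b → ev G (a ⋄ b)) q) ∎

  ev-letter⋄ : ∀ (G : A → Carrier) d q → ev G (letter d ⋄ₗ q) ≈ ev (λ b → ev G (d ⋄ b)) q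
  ev-letter⋄ G d q = trans (ev-⋄ G (letter d) q) (ev-single (λ a → ev (λ b → ev G (a ⋄ b)) q) d)

  ev-⋄letter : ∀ (G : A → Carrier) p d → ev G (p ⋄ₗ letter d) ≈ ev (λ a → ev G (a ⋄ d)) p
  ev-⋄letter G p d = trans (ev-⋄ G p (letter d)) (ev-cong (λ a → ev-single (λ b → ev G (a ⋄ b)) d) p)

  -- A combination all of whose
  -- coefficients vanish pairs to 0: remove all occurrences of its first letter
  -- (their coefficients add up to 0) and recurse on the shorter rest.
  coeffKA-here : ∀ x b z → coeffKA ((x , b) ∷ z) b ≈ x + coeffKA z b
  coeffKA-here x b z with b ≟A b
  ... | yes _ = refl
  ... | no b≢b = ⊥-elim (b≢b ≡.refl)

  coeffKA-there : ∀ x d b z → ¬ (d ≡ b) → coeffKA ((x , d) ∷ z) b ≈ coeffKA z b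
  coeffKA-there x d b z d≢b with d ≟A b
  ... | yes d≡b = ⊥-elim (d≢b d≡b)
  ... | no  _   = refl

  remove : A → KA → KA
  remove a [] = []
  remove a ((x , d) ∷ z) with d ≟A a
  ... | yes _ = remove a z
  ... | no  _ = (x , d) ∷ remove a z

  remove-length : ∀ a z → length (remove a z) ≤ length z
  remove-length a [] = z≤n
  remove-length a ((x , d) ∷ z) with d ≟A a
  ... | yes _ = m≤n⇒m≤1+n (remove-length a z)
  ... | no  _ = s≤s (remove-length a z)

  coeffKA-remove-same : ∀ a z → coeffKA (remove a z) a ≈ 0#
  coeffKA-remove-same a [] = refl
  coeffKA-remove-same a ((x , d) ∷ z) with d ≟A a
  ... | yes _   = coeffKA-remove-same a z
  ... | no  d≢a = trans (coeffKA-there x d a (remove a z) d≢a) (coeffKA-remove-same a z)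

  coeffKA-remove-other : ∀ a b z → ¬ (b ≡ a) → coeffKA (remove a z) b ≈ coeffKA z b
  coeffKA-remove-other a b [] b≢a = refl
  coeffKA-remove-other a b ((x , d) ∷ z) b≢a with d ≟A a
  ... | yes ≡.refl = trans (coeffKA-remove-other a b z b≢a) (sym (coeffKA-there x a b z (λ e → b≢a (≡.sym e))))
  ... | no  _      = kept (d ≟A b)
    where
    kept : Dec (d ≡ b) → coeffKA ((x , d) ∷ remove a z) b ≈ coeffKA ((x , d) ∷ z) b
    kept (yes ≡.refl) = trans (coeffKA-here x d (remove a z))
                              (trans (+-congˡ (coeffKA-remove-other a d z b≢a)) (sym (coeffKA-here x d z)))
    kept (no d≢b)     = trans (coeffKA-there x d b (remove a z) d≢b)
                              (trans (coeffKA-remove-other a b z b≢a) (sym (coeffKA-there x d b z d≢b)))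

  ev-remove : ∀ (G : A → Carrier) a z → ev G z ≈ coeffKA z a * G a + ev G (remove a z)
  ev-remove G a [] = sym (trans (+-identityʳ _) (zeroˡ _))
  ev-remove G a ((x , d) ∷ z) with d ≟A a
  ... | yes ≡.refl = begin
        x * G d + ev G z                                   ≈⟨ +-congˡ (ev-remove G d z) ⟩
        x * G d + (coeffKA z d * G d + ev G (remove d z))
          ≈⟨ solve 4 (λ a b c d → a :* b :+ (c :* b :+ d) := (a :+ c) :* b :+ d) refl _ _ _ _ ⟩
        (x + coeffKA z d) * G d + ev G (remove d z)        ∎
  ... | no _ = begin
        x * G d + ev G z                                   ≈⟨ +-congˡ (ev-remove G a z) ⟩
        x * G d + (coeffKA z a * G a + ev G (remove a z))
          ≈⟨ solve 3 (λ a c d → a :+ (c :+ d) := c :+ (a :+ d)) refl _ _ _ ⟩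
        coeffKA z a * G a + (x * G d + ev G (remove a z))  ∎

  -- induction on a bound n for the length
  ev-coeffKA-zero : ∀ n (G : A → Carrier) z → length z ≤ n → (∀ b → coeffKA z b ≈ 0#) → ev G z ≈ 0#
  ev-coeffKA-zero n       G []            _         _    = refl
  ev-coeffKA-zero (suc n) G ((x , d) ∷ z) (s≤s |z|≤n) z≈0 = begin
    x * G d + ev G z                                   ≈⟨ +-congˡ (ev-remove G d z) ⟩
    x * G d + (coeffKA z d * G d + ev G (remove d z))
      ≈⟨ solve 4 (λ a b c d → a :* b :+ (c :* b :+ d) := (a :+ c) :* b :+ d) refl _ _ _ _ ⟩
    (x + coeffKA z d) * G d + ev G (remove d z)
      ≈⟨ +-cong (*-congʳ (trans (sym (coeffKA-here x d z)) (z≈0 d)))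
                (ev-coeffKA-zero n G (remove d z) (≤-trans (remove-length d z) |z|≤n) rest≈0) ⟩
    0# * G d + 0#                                      ≈⟨ trans (+-identityʳ _) (zeroˡ _) ⟩
    0#                                                 ∎
    where
    rest≈0 : ∀ b → coeffKA (remove d z) b ≈ 0#
    rest≈0 b with b ≟A d
    ... | yes ≡.refl = coeffKA-remove-same d z
    ... | no  b≢d    = trans (coeffKA-remove-other d b z b≢d)
                             (trans (sym (coeffKA-there x d b z (λ e → b≢d (≡.sym e)))) (z≈0 b))

  coeffKA-++ : ∀ p q b → coeffKA (p ++ q) b ≈ coeffKA p b + coeffKA q b
  coeffKA-++ [] q b = sym (+-identityˡ _)
  coeffKA-++ ((x , d) ∷ p) q b with d ≟A b
  ... | yes _ = trans (+-congˡ (coeffKA-++ p q b)) (sym (+-assoc _ _ _))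
  ... | no  _ = coeffKA-++ p q b

  coeffKA-scale : ∀ x q b → coeffKA (scale x q) b ≈ x * coeffKA q b
  coeffKA-scale x [] b = sym (zeroʳ x)
  coeffKA-scale x ((y , d) ∷ q) b with d ≟A b
  ... | yes _ = trans (+-congˡ (coeffKA-scale x q b)) (sym (distribˡ _ _ _))
  ... | no  _ = coeffKA-scale x q b

  -- apply the above to p - q
  ≈KA⇒∼K : ∀ {p q} → p ≈KA q → p ∼K q
  ≈KA⇒∼K {p} {q} p≈q G = x∙y⁻¹≈ε⇒x≈y _ _ (begin
    ev G p + - ev G q                 ≈⟨ +-congˡ (sym (-1*x≈-x _)) ⟩
    ev G p + - 1# * ev G q            ≈⟨ +-congˡ (sym (ev-rescale G (- 1#) (λ u → u) q)) ⟩
    ev G p + ev G (scale (- 1#) q)    ≈⟨ sym (ev-++ G p (scale (- 1#) q)) ⟩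
    ev G (p ++ scale (- 1#) q)        ≈⟨ ev-coeffKA-zero _ G (p ++ scale (- 1#) q) ≤-refl difference≈0 ⟩
    0#                                ∎)
    where
    difference≈0 : ∀ b → coeffKA (p ++ scale (- 1#) q) b ≈ 0#
    difference≈0 b = begin
      coeffKA (p ++ scale (- 1#) q) b          ≈⟨ coeffKA-++ p (scale (- 1#) q) b ⟩
      coeffKA p b + coeffKA (scale (- 1#) q) b ≈⟨ +-cong (p≈q b) (trans (coeffKA-scale (- 1#) q b) (-1*x≈-x _)) ⟩
      coeffKA q b + - coeffKA q b              ≈⟨ -‿inverseʳ _ ⟩
      0#                                       ∎

  module Associativity (⋄-assoc : Associative⋄) where
    ev-⋄-assoc-letters : ∀ (G : A → Carrier) a b c →
      ev (λ e → ev G (e ⋄ c)) (a ⋄ b) ≈ ev (λ e → ev G (a ⋄ e)) (b ⋄ c)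
    ev-⋄-assoc-letters G a b c = begin
      ev (λ e → ev G (e ⋄ c)) (a ⋄ b) ≈⟨ sym (ev-⋄letter G (a ⋄ b) c) ⟩
      ev G ((a ⋄ b) ⋄ₗ letter c)      ≈⟨ ≈KA⇒∼K {(a ⋄ b) ⋄ₗ letter c} {letter a ⋄ₗ (b ⋄ c)} (⋄-assoc a b c) G ⟩
      ev G (letter a ⋄ₗ (b ⋄ c))      ≈⟨ ev-letter⋄ G a (b ⋄ c) ⟩
      ev (λ e → ev G (a ⋄ e)) (b ⋄ c) ∎

    ⋄ₗ-assoc : ∀ p q r → (p ⋄ₗ q) ⋄ₗ r ∼K p ⋄ₗ (q ⋄ₗ r)
    ⋄ₗ-assoc p q r G = begin
      ev G ((p ⋄ₗ q) ⋄ₗ r)                             ≈⟨ ev-⋄ G (p ⋄ₗ q) r ⟩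
      ev (λ e → ev (λ c → ev G (e ⋄ c)) r) (p ⋄ₗ q)     ≈⟨ ev-⋄ _ p q ⟩
      ev (λ a → ev (λ b → ev (λ e → ev (λ c → ev G (e ⋄ c)) r) (a ⋄ b)) q) p
        ≈⟨ ev-cong (λ a → ev-cong (λ b → ev-swap (λ e c → ev G (e ⋄ c)) (a ⋄ b) r) q) p ⟩
      ev (λ a → ev (λ b → ev (λ c → ev (λ e → ev G (e ⋄ c)) (a ⋄ b)) r) q) p
        ≈⟨ ev-cong (λ a → ev-cong (λ b → ev-cong (λ c → ev-⋄-assoc-letters G a b c) r) q) p ⟩
      ev (λ a → ev (λ b → ev (λ c → ev (λ e → ev G (a ⋄ e)) (b ⋄ c)) r) q) p
        ≈⟨ ev-cong (λ a → sym (ev-⋄ (λ e → ev G (a ⋄ e)) q r)) p ⟩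
      ev (λ a → ev (λ e → ev G (a ⋄ e)) (q ⋄ₗ r)) p     ≈⟨ sym (ev-⋄ G p (q ⋄ₗ r)) ⟩
      ev G (p ⋄ₗ (q ⋄ₗ r))                             ∎

  -- Ψ_f on "words" e b₁ ⋯ bₙ whose letters are elements of kA.  The first
  -- block, which already contains e, is weighted by the sequence F (F i for a
  -- block of i+1 letters) instead of f; at each bᵢ one either closes the
  -- current block (weight F 0) or merges bᵢ into it (e ↦ e ⋄ bᵢ, F ↦ shift F).
  Ψmulti : Seq → Seq → KA → List KA → Poly
  Ψmulti F f e []       = scaleP (F 0) (embed e · one)
  Ψmulti F f e (b ∷ bs) = scaleP (F 0) (embed e · Ψmulti (shift f) f b bs) ++ Ψmulti (shift F) f (e ⋄ₗ b) bs

  ev-embed·-linear : ∀ (G : List A → Carrier) e Q → ev G (embed e · Q) ≈ ev (λ d → ev G (embed (letter d) · Q)) e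
  ev-embed·-linear G e Q = trans (ev-embed· G e Q) (ev-cong (λ d → sym (ev-letter· G d Q)) e)

  ev-scale-++ : ∀ (G : List A → Carrier) x P Q → ev G (scaleP x P ++ Q) ≈ x * ev G P + ev G Q
  ev-scale-++ G x P Q = trans (ev-++ G (scaleP x P) Q) (+-congʳ (ev-scaleP G x P))

  Ψmulti-linear : ∀ f bs F e (G : List A → Carrier) →
    ev G (Ψmulti F f e bs) ≈ ev (λ d → ev G (Ψmulti F f (letter d) bs)) e
  Ψmulti-linear f [] F e G = begin
    ev G (scaleP (F 0) (embed e · one))                        ≈⟨ ev-scaleP G (F 0) (embed e · one) ⟩
    F 0 * ev G (embed e · one)                                 ≈⟨ *-congˡ (ev-embed·-linear G e one) ⟩
    F 0 * ev (λ d → ev G (embed (letter d) · one)) e           ≈⟨ sym (ev-* (F 0) _ e) ⟩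
    ev (λ d → F 0 * ev G (embed (letter d) · one)) e
      ≈⟨ ev-cong (λ d → sym (ev-scaleP G (F 0) (embed (letter d) · one))) e ⟩
    ev (λ d → ev G (scaleP (F 0) (embed (letter d) · one))) e  ∎
  Ψmulti-linear f (b ∷ bs) F e G = begin
    ev G (scaleP (F 0) (embed e · X) ++ Ψmulti F′ f (e ⋄ₗ b) bs)       ≈⟨ ev-scale-++ G (F 0) (embed e · X) _ ⟩
    F 0 * ev G (embed e · X) + ev G (Ψmulti F′ f (e ⋄ₗ b) bs)
      ≈⟨ +-cong (*-congˡ (ev-embed·-linear G e X)) (Ψmulti-linear f bs F′ (e ⋄ₗ b) G) ⟩
    F 0 * ev (λ d → ev G (embed (letter d) · X)) e + ev K (e ⋄ₗ b)
      ≈⟨ +-cong (sym (ev-* (F 0) _ e)) (ev-⋄ K e b) ⟩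
    ev (λ d → F 0 * ev G (embed (letter d) · X)) e + ev (λ a → ev (λ b′ → ev K (a ⋄ b′)) b) e
      ≈⟨ sym (ev-+ _ _ e) ⟩
    ev (λ d → F 0 * ev G (embed (letter d) · X) + ev (λ b′ → ev K (d ⋄ b′)) b) e
      ≈⟨ ev-cong (λ d → sym (at-letter d)) e ⟩
    ev (λ d → ev G (Ψmulti F f (letter d) (b ∷ bs))) e ∎
    where
    X  = Ψmulti (shift f) f b bs
    F′ = shift F
    K  = λ d′ → ev G (Ψmulti F′ f (letter d′) bs)
    at-letter : ∀ d → ev G (Ψmulti F f (letter d) (b ∷ bs)) ≈ F 0 * ev G (embed (letter d) · X) + ev (λ b′ → ev K (d ⋄ b′)) b
    at-letter d = begin
      ev G (scaleP (F 0) (embed (letter d) · X) ++ Ψmulti F′ f (letter d ⋄ₗ b) bs)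
        ≈⟨ ev-scale-++ G (F 0) (embed (letter d) · X) _ ⟩
      F 0 * ev G (embed (letter d) · X) + ev G (Ψmulti F′ f (letter d ⋄ₗ b) bs)
        ≈⟨ +-congˡ (trans (Ψmulti-linear f bs F′ (letter d ⋄ₗ b) G) (ev-letter⋄ K d b)) ⟩
      F 0 * ev G (embed (letter d) · X) + ev (λ b′ → ev K (d ⋄ b′)) b ∎

  Ψmulti-cong : ∀ f bs F {e e′} → e ∼K e′ → Ψmulti F f e bs ∼ Ψmulti F f e′ bs
  Ψmulti-cong f bs F {e} {e′} e∼e′ G =
    trans (Ψmulti-linear f bs F e G) (trans (e∼e′ _) (sym (Ψmulti-linear f bs F e′ G)))

  Ψmulti-linearF : ∀ f bs x F₁ F₂ e →
    Ψmulti (λ k → x * F₁ k + F₂ k) f e bs ∼ scaleP x (Ψmulti F₁ f e bs) ++ Ψmulti F₂ f e bs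
  Ψmulti-linearF f [] x F₁ F₂ e G = begin
    ev G (scaleP (x * F₁ 0 + F₂ 0) E)                       ≈⟨ ev-scaleP G (x * F₁ 0 + F₂ 0) E ⟩
    (x * F₁ 0 + F₂ 0) * ev G E
      ≈⟨ solve 4 (λ x a b e → (x :* a :+ b) :* e := x :* (a :* e) :+ b :* e) refl x (F₁ 0) (F₂ 0) (ev G E) ⟩
    x * (F₁ 0 * ev G E) + F₂ 0 * ev G E
      ≈⟨ sym (+-cong (trans (ev-scaleP G x (scaleP (F₁ 0) E)) (*-congˡ (ev-scaleP G (F₁ 0) E))) (ev-scaleP G (F₂ 0) E)) ⟩
    ev G (scaleP x (scaleP (F₁ 0) E)) + ev G (scaleP (F₂ 0) E) ≈⟨ sym (ev-++ G (scaleP x (scaleP (F₁ 0) E)) (scaleP (F₂ 0) E)) ⟩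
    ev G (scaleP x (scaleP (F₁ 0) E) ++ scaleP (F₂ 0) E)    ∎
    where E = embed e · one
  Ψmulti-linearF f (b ∷ bs) x F₁ F₂ e G = begin
    ev G (scaleP (x * F₁ 0 + F₂ 0) E ++ Ψmulti (λ k → x * F₁ (suc k) + F₂ (suc k)) f (e ⋄ₗ b) bs)
      ≈⟨ ev-scale-++ G (x * F₁ 0 + F₂ 0) E _ ⟩
    (x * F₁ 0 + F₂ 0) * ev G E + ev G (Ψmulti (λ k → x * F₁ (suc k) + F₂ (suc k)) f (e ⋄ₗ b) bs)
      ≈⟨ +-congˡ (trans (Ψmulti-linearF f bs x (shift F₁) (shift F₂) (e ⋄ₗ b) G) (ev-scale-++ G x R₁ R₂)) ⟩
    (x * F₁ 0 + F₂ 0) * ev G E + (x * ev G R₁ + ev G R₂)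
      ≈⟨ solve 6 (λ x a b e r₁ r₂ → (x :* a :+ b) :* e :+ (x :* r₁ :+ r₂) := x :* (a :* e :+ r₁) :+ (b :* e :+ r₂))
               refl x (F₁ 0) (F₂ 0) (ev G E) (ev G R₁) (ev G R₂) ⟩
    x * (F₁ 0 * ev G E + ev G R₁) + (F₂ 0 * ev G E + ev G R₂)
      ≈⟨ sym (+-cong (trans (ev-scaleP G x (scaleP (F₁ 0) E ++ R₁)) (*-congˡ (ev-scale-++ G (F₁ 0) E R₁)))
                     (ev-scale-++ G (F₂ 0) E R₂)) ⟩
    ev G (scaleP x (scaleP (F₁ 0) E ++ R₁)) + ev G (scaleP (F₂ 0) E ++ R₂)
      ≈⟨ sym (ev-++ G (scaleP x (scaleP (F₁ 0) E ++ R₁)) (scaleP (F₂ 0) E ++ R₂)) ⟩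
    ev G (scaleP x (scaleP (F₁ 0) E ++ R₁) ++ (scaleP (F₂ 0) E ++ R₂)) ∎
    where
    E  = embed e · Ψmulti (shift f) f b bs
    R₁ = Ψmulti (shift F₁) f (e ⋄ₗ b) bs
    R₂ = Ψmulti (shift F₂) f (e ⋄ₗ b) bs

  -- Ψ_f with the weight of the first block replaced by F, on words of letters
  Φword : Seq → Seq → List A → Poly
  Φword F f []      = one
  Φword F f (x ∷ w) = Ψmulti F f (letter x) (map letter w)

  Φ : Seq → Seq → Poly → Poly
  Φ F f = linExt (Φword F f)

  extend : List ℕ → List (List ℕ)
  extend []      = (1 ∷ []) ∷ []
  extend (i ∷ I) = (1 ∷ i ∷ I) ∷ (suc i ∷ I) ∷ []

  compositions-suc : ∀ n → compositions (suc n) ≡ concatMap extend (compositions n)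
  compositions-suc n = concatMap-cong (λ { [] → ≡.refl ; (i ∷ I) → ≡.refl }) (compositions n)

  PositiveHead : List ℕ → Set
  PositiveHead []          = ⊥
  PositiveHead (zero  ∷ _) = ⊥
  PositiveHead (suc _ ∷ _) = ⊤

  extend-positive : ∀ Is → All PositiveHead (concatMap extend Is)
  extend-positive []            = All.[]
  extend-positive ([] ∷ Is)     = tt All.∷ extend-positive Is
  extend-positive ((i ∷ I) ∷ Is) = tt All.∷ tt All.∷ extend-positive Is

  compositions-positive : ∀ n → All PositiveHead (compositions (suc n))
  compositions-positive n = ≡.subst (All PositiveHead) (≡.sym (compositions-suc n)) (extend-positive (compositions n))

  concatMap-cong-positive : ∀ {φ ψ : List ℕ → Poly} → (∀ j I → φ (suc j ∷ I) ≡ ψ (suc j ∷ I)) →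
    ∀ {Is} → All PositiveHead Is → concatMap φ Is ≡ concatMap ψ Is
  concatMap-cong-positive φ≡ψ All.[] = ≡.refl
  concatMap-cong-positive {φ} {ψ} φ≡ψ {(suc j ∷ I) ∷ _} (tt All.∷ ps) =
    ≡.cong₂ _++_ (φ≡ψ j I) (concatMap-cong-positive {φ} {ψ} φ≡ψ ps)

  ev-embed·-++ : ∀ (G : List A → Carrier) b P Q → ev G (embed b · (P ++ Q)) ≈ ev G (embed b · P) + ev G (embed b · Q)
  ev-embed·-++ G b P Q = begin
    ev G (embed b · (P ++ Q))                          ≈⟨ ev-embed· G b (P ++ Q) ⟩
    ev (λ d → ev (λ v → G (d ∷ v)) (P ++ Q)) b         ≈⟨ ev-cong (λ d → ev-++ (λ v → G (d ∷ v)) P Q) b ⟩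
    ev (λ d → ev (λ v → G (d ∷ v)) P + ev (λ v → G (d ∷ v)) Q) b
      ≈⟨ ev-+ (λ d → ev (λ v → G (d ∷ v)) P) (λ d → ev (λ v → G (d ∷ v)) Q) b ⟩
    ev (λ d → ev (λ v → G (d ∷ v)) P) b + ev (λ d → ev (λ v → G (d ∷ v)) Q) b
      ≈⟨ sym (+-cong (ev-embed· G b P) (ev-embed· G b Q)) ⟩
    ev G (embed b · P) + ev G (embed b · Q)            ∎

  ev-embed·-scale : ∀ (G : List A → Carrier) b x P → ev G (embed b · scaleP x P) ≈ x * ev G (embed b · P)
  ev-embed·-scale G b x P = begin
    ev G (embed b · scaleP x P)                 ≈⟨ ev-embed· G b (scaleP x P) ⟩
    ev (λ d → ev (λ v → G (d ∷ v)) (scaleP x P)) b ≈⟨ ev-cong (λ d → ev-scaleP (λ v → G (d ∷ v)) x P) b ⟩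
    ev (λ d → x * ev (λ v → G (d ∷ v)) P) b     ≈⟨ ev-* x (λ d → ev (λ v → G (d ∷ v)) P) b ⟩
    x * ev (λ d → ev (λ v → G (d ∷ v)) P) b     ≈⟨ *-congˡ (sym (ev-embed· G b P)) ⟩
    x * ev G (embed b · P)                      ∎

  ev-embed·-[] : ∀ (G : List A → Carrier) b → ev G (embed b · []) ≈ 0#
  ev-embed·-[] G b = trans (ev-embed· G b []) (ev-0 b)

  -- The sum defining Ψword, reorganised along the recursion of Ψmulti.
  module ΨwordAsΨmulti (f : Seq) where
    -- the summand of a composition I when the first block already contains b
    -- and continues with the letters of u
    summand : Seq → KA → List A → List ℕ → Poly
    summand F b u []          = []
    summand F b u (zero  ∷ I) = []
    summand F b u (suc j ∷ I) =
      scaleP (F j * prodCoeffs f I) (embed (foldl (λ p d → p ⋄ₗ letter d) b (take j u)) · applyComp I (drop j u))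

    -- each composition I gives one composition (1 ∷ I) closing the first
    -- block, and one enlarging it
    summands-extend : ∀ F b x v (G : List A → Carrier) {Is} → All PositiveHead Is →
      ev G (concatMap (summand F b (x ∷ v)) (concatMap extend Is))
        ≈ F 0 * ev G (embed b · concatMap (λ I → scaleP (prodCoeffs f I) (applyComp I (x ∷ v))) Is)
          + ev G (concatMap (summand (shift F) (b ⋄ₗ letter x) v) Is)
    summands-extend F b x v G All.[] = sym (trans (+-congʳ (trans (*-congˡ (ev-embed·-[] G b)) (zeroʳ _))) (+-identityˡ _))
    summands-extend F b x v G {(suc j ∷ I) ∷ Is} (tt All.∷ ps) = begin
      ev G (T₁ ++ (T₂ ++ Rest))          ≈⟨ trans (ev-++ G T₁ (T₂ ++ Rest)) (+-congˡ (ev-++ G T₂ Rest)) ⟩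
      ev G T₁ + (ev G T₂ + ev G Rest)
        ≈⟨ +-cong (ev-scaleP G (F 0 * fI) (embed b · AI)) (+-congˡ (summands-extend F b x v G ps)) ⟩
      (F 0 * fI) * ev G (embed b · AI) + (ev G T₂ + (F 0 * ev G (embed b · Q) + ev G R′))
        ≈⟨ solve 6 (λ F₀ fI e t₂ q r → F₀ :* fI :* e :+ (t₂ :+ (F₀ :* q :+ r)) := F₀ :* (fI :* e :+ q) :+ (t₂ :+ r)) refl
                   (F 0) fI (ev G (embed b · AI)) (ev G T₂) (ev G (embed b · Q)) (ev G R′) ⟩
      F 0 * (fI * ev G (embed b · AI) + ev G (embed b · Q)) + (ev G T₂ + ev G R′)
        ≈⟨ sym (+-cong (*-congˡ (trans (ev-embed·-++ G b (scaleP fI AI) Q) (+-congʳ (ev-embed·-scale G b fI AI))))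
                       (ev-++ G T₂ R′)) ⟩
      F 0 * ev G (embed b · (scaleP fI AI ++ Q)) + ev G (T₂ ++ R′) ∎
      where
      fI   = prodCoeffs f (suc j ∷ I)
      AI   = applyComp (suc j ∷ I) (x ∷ v)
      T₁   = scaleP (F 0 * fI) (embed b · AI)
      T₂   = summand (shift F) (b ⋄ₗ letter x) v (suc j ∷ I)
      Rest = concatMap (summand F b (x ∷ v)) (concatMap extend Is)
      Q    = concatMap (λ I → scaleP (prodCoeffs f I) (applyComp I (x ∷ v))) Is
      R′   = concatMap (summand (shift F) (b ⋄ₗ letter x) v) Is

    Ψword-as-summands : ∀ x v → Ψword f (x ∷ v) ≡ concatMap (summand (shift f) (letter x) v) (compositions (suc (length v)))
    Ψword-as-summands x v = concatMap-cong-positive (λ j I → ≡.refl) (compositions-positive (length v))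

    summands≈Ψmulti : ∀ u F b → concatMap (summand F b u) (compositions (suc (length u))) ∼ Ψmulti F f b (map letter u)
    summands≈Ψmulti [] F b G = begin
      ev G (scaleP (F 0 * 1#) (embed b · one) ++ [])
        ≈⟨ trans (ev-++ G (scaleP (F 0 * 1#) (embed b · one)) []) (+-identityʳ _) ⟩
      ev G (scaleP (F 0 * 1#) (embed b · one))
        ≈⟨ trans (ev-scaleP G (F 0 * 1#) (embed b · one)) (*-congʳ (*-identityʳ _)) ⟩
      F 0 * ev G (embed b · one) ≈⟨ sym (ev-scaleP G (F 0) (embed b · one)) ⟩
      ev G (scaleP (F 0) (embed b · one)) ∎
    summands≈Ψmulti (x ∷ v) F b G = begin
      ev G (concatMap (summand F b (x ∷ v)) (compositions (suc (suc (length v)))))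
        ≈⟨ reflexive (≡.cong (λ Is → ev G (concatMap (summand F b (x ∷ v)) Is)) (compositions-suc (suc (length v)))) ⟩
      ev G (concatMap (summand F b (x ∷ v)) (concatMap extend (compositions (suc (length v)))))
        ≈⟨ summands-extend F b x v G (compositions-positive (length v)) ⟩
      F 0 * ev G (embed b · Ψword f (x ∷ v)) + ev G (concatMap (summand (shift F) (b ⋄ₗ letter x) v) (compositions (suc (length v))))
        ≈⟨ +-cong (*-congˡ (∼-·ʳ (embed b) {Ψword f (x ∷ v)} {Ψmulti (shift f) f (letter x) (map letter v)}
                      (λ H → trans (reflexive (≡.cong (ev H) (Ψword-as-summands x v))) (summands≈Ψmulti v (shift f) (letter x) H)) G))
                  (summands≈Ψmulti v (shift F) (b ⋄ₗ letter x) G) ⟩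
      F 0 * ev G (embed b · Ψmulti (shift f) f (letter x) (map letter v)) + ev G (Ψmulti (shift F) f (b ⋄ₗ letter x) (map letter v))
        ≈⟨ sym (ev-scale-++ G (F 0) (embed b · Ψmulti (shift f) f (letter x) (map letter v)) _) ⟩
      ev G (Ψmulti F f b (map letter (x ∷ v))) ∎

    Ψword≈Φword : ∀ w → Ψword f w ∼ Φword (shift f) f w
    Ψword≈Φword []      G = trans (trans (ev-++ G (scaleP 1# (applyComp [] [])) []) (+-identityʳ _))
                                  (trans (ev-scaleP G 1# one) (*-identityˡ _))
    Ψword≈Φword (x ∷ v) G = trans (reflexive (≡.cong (ev G) (Ψword-as-summands x v))) (summands≈Ψmulti v (shift f) (letter x) G)

  Ψ≈Φ : ∀ f P → Ψ f P ∼ Φ (shift f) f P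
  Ψ≈Φ f = ∼-linExt-pointwise (ΨwordAsΨmulti.Ψword≈Φword f)

  mergeWord : KA → List A → Poly
  mergeWord c []      = []
  mergeWord c (x ∷ w) = embed (c ⋄ₗ letter x) · [ (1# , w) ]

  merge : KA → Poly → Poly
  merge c = linExt (mergeWord c)

  ev-mergeWord : ∀ (L : List A → Carrier) c x w → ev L (mergeWord c (x ∷ w)) ≈ ev (λ a → ev (λ e → L (e ∷ w)) (a ⋄ x)) c
  ev-mergeWord L c x w = begin
    ev L (embed (c ⋄ₗ letter x) · [ (1# , w) ])           ≈⟨ ev-embed· L (c ⋄ₗ letter x) [ (1# , w) ] ⟩
    ev (λ e → ev (λ v → L (e ∷ v)) [ (1# , w) ]) (c ⋄ₗ letter x)
      ≈⟨ ev-cong (λ e → ev-single (λ v → L (e ∷ v)) w) (c ⋄ₗ letter x) ⟩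
    ev (λ e → L (e ∷ w)) (c ⋄ₗ letter x)                  ≈⟨ ev-⋄letter (λ e → L (e ∷ w)) c x ⟩
    ev (λ a → ev (λ e → L (e ∷ w)) (a ⋄ x)) c             ∎

  merge-embed· : ∀ c d Q → merge c (embed d · Q) ∼ embed (c ⋄ₗ d) · Q
  merge-embed· c d Q L = begin
    ev L (merge c (embed d · Q))                     ≈⟨ ev-linExt L (mergeWord c) (embed d · Q) ⟩
    ev (λ u → ev L (mergeWord c u)) (embed d · Q)    ≈⟨ ev-embed· (λ u → ev L (mergeWord c u)) d Q ⟩
    ev (λ d′ → ev (λ v → ev L (mergeWord c (d′ ∷ v))) Q) d ≈⟨ ev-cong (λ d′ → ev-cong (λ v → ev-mergeWord L c d′ v) Q) d ⟩
    ev (λ d′ → ev (λ v → ev (λ a → ev (λ e → L (e ∷ v)) (a ⋄ d′)) c) Q) d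
      ≈⟨ ev-cong (λ d′ → ev-swap (λ v a → ev (λ e → L (e ∷ v)) (a ⋄ d′)) Q c) d ⟩
    ev (λ d′ → ev (λ a → ev (λ v → ev (λ e → L (e ∷ v)) (a ⋄ d′)) Q) c) d
      ≈⟨ ev-swap (λ d′ a → ev (λ v → ev (λ e → L (e ∷ v)) (a ⋄ d′)) Q) d c ⟩
    ev (λ a → ev (λ d′ → ev (λ v → ev (λ e → L (e ∷ v)) (a ⋄ d′)) Q) d) c
      ≈⟨ ev-cong (λ a → ev-cong (λ d′ → ev-swap (λ v e → L (e ∷ v)) Q (a ⋄ d′)) d) c ⟩
    ev (λ a → ev (λ d′ → ev (λ e → ev (λ v → L (e ∷ v)) Q) (a ⋄ d′)) d) c
      ≈⟨ sym (ev-⋄ (λ e → ev (λ v → L (e ∷ v)) Q) c d) ⟩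
    ev (λ e → ev (λ v → L (e ∷ v)) Q) (c ⋄ₗ d)       ≈⟨ sym (ev-embed· L (c ⋄ₗ d) Q) ⟩
    ev L (embed (c ⋄ₗ d) · Q)                        ∎

  module Merge (⋄-assoc : Associative⋄) where
    open Associativity ⋄-assoc

    merge-Ψmulti : ∀ g ds G c d → merge c (Ψmulti G g d ds) ∼ Ψmulti G g (c ⋄ₗ d) ds
    merge-Ψmulti g [] G c d L = begin
      ev L (merge c (scaleP (G 0) (embed d · one)))         ≈⟨ ev-linExt-scale L (mergeWord c) (G 0) (embed d · one) ⟩
      G 0 * ev L (merge c (embed d · one))                  ≈⟨ *-congˡ (merge-embed· c d one L) ⟩
      G 0 * ev L (embed (c ⋄ₗ d) · one)                     ≈⟨ sym (ev-scaleP L (G 0) (embed (c ⋄ₗ d) · one)) ⟩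
      ev L (scaleP (G 0) (embed (c ⋄ₗ d) · one))            ∎
    merge-Ψmulti g (e ∷ es) G c d L = begin
      ev L (merge c (scaleP (G 0) (embed d · X) ++ R))
        ≈⟨ ev-linExt-scale-++ L (mergeWord c) (G 0) (embed d · X) R ⟩
      G 0 * ev L (merge c (embed d · X)) + ev L (merge c R)
        ≈⟨ +-cong (*-congˡ (merge-embed· c d X L)) (trans (merge-Ψmulti g es (shift G) c (d ⋄ₗ e) L)
                          (Ψmulti-cong g es (shift G) (λ H → sym (⋄ₗ-assoc c d e H)) L)) ⟩
      G 0 * ev L (embed (c ⋄ₗ d) · X) + ev L (Ψmulti (shift G) g ((c ⋄ₗ d) ⋄ₗ e) es)
        ≈⟨ sym (ev-scale-++ L (G 0) (embed (c ⋄ₗ d) · X) _) ⟩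
      ev L (Ψmulti G g (c ⋄ₗ d) (e ∷ es))                   ∎
      where
      X = Ψmulti (shift g) g e es
      R = Ψmulti (shift G) g (d ⋄ₗ e) es

  -- Φ_F(c·Y) = F₀ · c·Φ_{f₁}(Y) + Φ_{F₁}(merge c Y): the leading letter c
  -- either forms a block of its own or joins the first block of Y.
  module _ (F f : Seq) (c : KA) (L : List A → Carrier) where
    private
      alone : List A → Carrier
      alone w = ev (λ d → ev (λ v → L (d ∷ v)) (Φword (shift f) f w)) c
      joined : List A → Carrier
      joined w = ev (λ u → ev L (Φword (shift F) f u)) (mergeWord c w)

    Φword-cons : ∀ w → ev (λ d → ev L (Φword F f (d ∷ w))) c ≈ F 0 * alone w + joined w
    Φword-cons [] = begin
      ev (λ d → ev L (scaleP (F 0) (embed (letter d) · one))) c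
        ≈⟨ ev-cong (λ d → trans (ev-scaleP L (F 0) (embed (letter d) · one)) (*-congˡ (ev-letter· L d one))) c ⟩
      ev (λ d → F 0 * ev (λ v → L (d ∷ v)) one) c ≈⟨ ev-* (F 0) (λ d → ev (λ v → L (d ∷ v)) one) c ⟩
      F 0 * alone []                              ≈⟨ sym (+-identityʳ _) ⟩
      F 0 * alone [] + joined []                  ∎
    Φword-cons (x ∷ w) = begin
      ev (λ d → ev L (scaleP (F 0) (embed (letter d) · X) ++ Ψmulti (shift F) f (letter d ⋄ₗ letter x) W)) c
        ≈⟨ ev-cong at-letter c ⟩
      ev (λ d → F 0 * ev (λ v → L (d ∷ v)) X + ev K (d ⋄ x)) c
        ≈⟨ trans (ev-+ (λ d → F 0 * ev (λ v → L (d ∷ v)) X) (λ d → ev K (d ⋄ x)) c)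
                 (+-congʳ (ev-* (F 0) (λ d → ev (λ v → L (d ∷ v)) X) c)) ⟩
      F 0 * alone (x ∷ w) + ev (λ d → ev K (d ⋄ x)) c
        ≈⟨ +-congˡ (sym (ev-mergeWord (λ u → ev L (Φword (shift F) f u)) c x w)) ⟩
      F 0 * alone (x ∷ w) + joined (x ∷ w) ∎
      where
      W = map letter w
      X = Φword (shift f) f (x ∷ w)
      K = λ e → ev L (Ψmulti (shift F) f (letter e) W)
      at-letter : ∀ d → ev L (scaleP (F 0) (embed (letter d) · X) ++ Ψmulti (shift F) f (letter d ⋄ₗ letter x) W)
                        ≈ F 0 * ev (λ v → L (d ∷ v)) X + ev K (d ⋄ x)
      at-letter d = begin
        ev L (scaleP (F 0) (embed (letter d) · X) ++ Ψmulti (shift F) f (letter d ⋄ₗ letter x) W)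
          ≈⟨ ev-scale-++ L (F 0) (embed (letter d) · X) _ ⟩
        F 0 * ev L (embed (letter d) · X) + ev L (Ψmulti (shift F) f (letter d ⋄ₗ letter x) W)
          ≈⟨ +-cong (*-congˡ (ev-letter· L d X))
                    (trans (Ψmulti-linear f W (shift F) (letter d ⋄ₗ letter x) L)
                           (trans (ev-letter⋄ K d (letter x)) (ev-single (λ b → ev K (d ⋄ b)) x))) ⟩
        F 0 * ev (λ v → L (d ∷ v)) X + ev K (d ⋄ x) ∎

    ev-Φ-embed· : ∀ Y → ev L (Φ F f (embed c · Y))
                        ≈ F 0 * ev L (embed c · Φ (shift f) f Y) + ev L (Φ (shift F) f (merge c Y))
    ev-Φ-embed· Y = begin
      ev L (Φ F f (embed c · Y))                              ≈⟨ ev-linExt L (Φword F f) (embed c · Y) ⟩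
      ev (λ u → ev L (Φword F f u)) (embed c · Y)             ≈⟨ ev-embed· (λ u → ev L (Φword F f u)) c Y ⟩
      ev (λ d → ev (λ w → ev L (Φword F f (d ∷ w))) Y) c      ≈⟨ ev-swap (λ d w → ev L (Φword F f (d ∷ w))) c Y ⟩
      ev (λ w → ev (λ d → ev L (Φword F f (d ∷ w))) c) Y      ≈⟨ ev-cong Φword-cons Y ⟩
      ev (λ w → F 0 * alone w + joined w) Y                   ≈⟨ trans (ev-+ (λ w → F 0 * alone w) joined Y) (+-congʳ (ev-* (F 0) alone Y)) ⟩
      F 0 * ev alone Y + ev joined Y                          ≈⟨ sym (+-cong (*-congˡ alone-total) joined-total) ⟩
      F 0 * ev L (embed c · Φ (shift f) f Y) + ev L (Φ (shift F) f (merge c Y)) ∎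
      where
      alone-total : ev L (embed c · Φ (shift f) f Y) ≈ ev alone Y
      alone-total = begin
        ev L (embed c · Φ (shift f) f Y)                     ≈⟨ ev-embed· L c (Φ (shift f) f Y) ⟩
        ev (λ d → ev (λ v → L (d ∷ v)) (Φ (shift f) f Y)) c
          ≈⟨ ev-cong (λ d → ev-linExt (λ v → L (d ∷ v)) (Φword (shift f) f) Y) c ⟩
        ev (λ d → ev (λ w → ev (λ v → L (d ∷ v)) (Φword (shift f) f w)) Y) c
          ≈⟨ ev-swap (λ d w → ev (λ v → L (d ∷ v)) (Φword (shift f) f w)) c Y ⟩
        ev alone Y                                           ∎
      joined-total : ev L (Φ (shift F) f (merge c Y)) ≈ ev joined Y
      joined-total = trans (ev-linExt L (Φword (shift F) f) (merge c Y))
                           (ev-linExt (λ u → ev L (Φword (shift F) f u)) (mergeWord c) Y)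

  Φ-embed·one : ∀ F f c → Φ F f (embed c · one) ∼ Ψmulti F f c []
  Φ-embed·one F f c L = begin
    ev L (Φ F f (embed c · one))                       ≈⟨ ev-linExt L (Φword F f) (embed c · one) ⟩
    ev (λ u → ev L (Φword F f u)) (embed c · one)      ≈⟨ ev-embed· (λ u → ev L (Φword F f u)) c one ⟩
    ev (λ d → ev (λ v → ev L (Φword F f (d ∷ v))) one) c
      ≈⟨ ev-cong (λ d → ev-single (λ v → ev L (Φword F f (d ∷ v))) []) c ⟩
    ev (λ d → ev L (Ψmulti F f (letter d) [])) c       ≈⟨ sym (Ψmulti-linear f [] F c L) ⟩
    ev L (Ψmulti F f c [])                             ∎

  module Composition (⋄-assoc : Associative⋄) (f g : Seq) where
    open Merge ⋄-assoc

    h : Seq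
    h = compose f g

    Φ-Ψmulti : ∀ ds F G c → Φ F f (Ψmulti G g c ds) ∼ Ψmulti (compWith g F G) h c ds
    Φ-Ψmulti [] F G c L = begin
      ev L (Φ F f (scaleP (G 0) (embed c · one)))  ≈⟨ ev-linExt-scale L (Φword F f) (G 0) (embed c · one) ⟩
      G 0 * ev L (Φ F f (embed c · one))           ≈⟨ *-congˡ (Φ-embed·one F f c L) ⟩
      G 0 * ev L (Ψmulti F f c [])                 ≈⟨ *-congˡ (ev-scaleP L (F 0) (embed c · one)) ⟩
      G 0 * (F 0 * ev L (embed c · one))           ≈⟨ sym (*-assoc _ _ _) ⟩
      (G 0 * F 0) * ev L (embed c · one)           ≈⟨ sym (ev-scaleP L (G 0 * F 0) (embed c · one)) ⟩
      ev L (scaleP (G 0 * F 0) (embed c · one))    ∎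
    Φ-Ψmulti (d ∷ ds) F G c L = begin
      ev L (Φ F f (scaleP (G 0) (embed c · X) ++ R))  ≈⟨ ev-linExt-scale-++ L (Φword F f) (G 0) (embed c · X) R ⟩
      G 0 * ev L (Φ F f (embed c · X)) + ev L (Φ F f R)
        ≈⟨ +-cong (*-congˡ (ev-Φ-embed· F f c L X)) (Φ-Ψmulti ds F (shift G) (c ⋄ₗ d) L) ⟩
      G 0 * (F 0 * ev L (embed c · Φ (shift f) f X) + ev L (Φ (shift F) f (merge c X))) + ev L Y₃
        ≈⟨ +-congʳ (*-congˡ (+-cong (*-congˡ (∼-·ʳ (embed c) (Φ-Ψmulti ds (shift f) (shift g) d) L))
                                    (trans (∼-linExt (Φword (shift F) f) {merge c X} {Ψmulti (shift g) g (c ⋄ₗ d) ds}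
                                                     (merge-Ψmulti g ds (shift g) c d) L)
                                           (Φ-Ψmulti ds (shift F) (shift g) (c ⋄ₗ d) L)))) ⟩
      G 0 * (F 0 * ev L (embed c · Y₁) + ev L Y₂) + ev L Y₃
        ≈⟨ solve 5 (λ a b e y₂ y₃ → a :* (b :* e :+ y₂) :+ y₃ := a :* b :* e :+ (a :* y₂ :+ y₃))
                 refl (G 0) (F 0) (ev L (embed c · Y₁)) (ev L Y₂) (ev L Y₃) ⟩
      (G 0 * F 0) * ev L (embed c · Y₁) + (G 0 * ev L Y₂ + ev L Y₃)
        ≈⟨ +-congˡ (sym (trans (Ψmulti-linearF h ds (G 0) (compWith g (shift F) (shift g)) (compWith g F (shift G)) (c ⋄ₗ d) L)
                               (ev-scale-++ L (G 0) Y₂ Y₃))) ⟩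
      (G 0 * F 0) * ev L (embed c · Y₁) + ev L (Ψmulti (shift (compWith g F G)) h (c ⋄ₗ d) ds)
        ≈⟨ sym (ev-scale-++ L (G 0 * F 0) (embed c · Y₁) _) ⟩
      ev L (Ψmulti (compWith g F G) h c (d ∷ ds)) ∎
      where
      X  = Ψmulti (shift g) g d ds
      R  = Ψmulti (shift G) g (c ⋄ₗ d) ds
      Y₁ = Ψmulti (compWith g (shift f) (shift g)) h d ds
      Y₂ = Ψmulti (compWith g (shift F) (shift g)) h (c ⋄ₗ d) ds
      Y₃ = Ψmulti (compWith g F (shift G)) h (c ⋄ₗ d) ds

    Φ-Φword : ∀ w → Φ (shift f) f (Φword (shift g) g w) ∼ Φword (shift h) h w
    Φ-Φword []      L = trans (ev-linExt L (Φword (shift f) f) one) (ev-single (λ u → ev L (Φword (shift f) f u)) [])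
    Φ-Φword (x ∷ v) = Φ-Ψmulti (map letter v) (shift f) (shift g) (letter x)

    Ψ-comp-word : ∀ w → Ψ f (Ψword g w) ∼ Ψword h w
    Ψ-comp-word w L = begin
      ev L (Ψ f (Ψword g w))                     ≈⟨ ∼-linExt (Ψword f) {Ψword g w} {Φword (shift g) g w} (ΨwordAsΨmulti.Ψword≈Φword g w) L ⟩
      ev L (Ψ f (Φword (shift g) g w))           ≈⟨ Ψ≈Φ f (Φword (shift g) g w) L ⟩
      ev L (Φ (shift f) f (Φword (shift g) g w)) ≈⟨ Φ-Φword w L ⟩
      ev L (Φword (shift h) h w)                 ≈⟨ sym (ΨwordAsΨmulti.Ψword≈Φword h w L) ⟩
      ev L (Ψword h w)                           ∎

    Ψ-comp : ∀ P → Ψ f (Ψ g P) ∼ Ψ h P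
    Ψ-comp P L = trans (linExt-linExt (Ψword f) (Ψword g) P L) (∼-linExt-pointwise Ψ-comp-word P L)

  Ψ-cong : ∀ {f f′} → (∀ k → f k ≈ f′ k) → ∀ P → Ψ f P ∼ Ψ f′ P
  Ψ-cong {f} {f′} f≈f′ = ∼-linExt-pointwise (λ w → sum-cong (compositions (length w)) w)
    where
    prodCoeffs-cong : ∀ I → prodCoeffs f I ≈ prodCoeffs f′ I
    prodCoeffs-cong []      = refl
    prodCoeffs-cong (i ∷ I) = *-cong (f≈f′ i) (prodCoeffs-cong I)
    sum-cong : ∀ Is w → concatMap (λ I → scaleP (prodCoeffs f I) (applyComp I w)) Is
                        ∼ concatMap (λ I → scaleP (prodCoeffs f′ I) (applyComp I w)) Is
    sum-cong []       w G = refl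
    sum-cong (I ∷ Is) w G = begin
      ev G (scaleP (prodCoeffs f I) (applyComp I w) ++ S)    ≈⟨ ev-scale-++ G (prodCoeffs f I) (applyComp I w) S ⟩
      prodCoeffs f I * ev G (applyComp I w) + ev G S         ≈⟨ +-cong (*-congʳ (prodCoeffs-cong I)) (sum-cong Is w G) ⟩
      prodCoeffs f′ I * ev G (applyComp I w) + ev G S′       ≈⟨ sym (ev-scale-++ G (prodCoeffs f′ I) (applyComp I w) S′) ⟩
      ev G (scaleP (prodCoeffs f′ I) (applyComp I w) ++ S′)  ∎
      where
      S  = concatMap (λ I → scaleP (prodCoeffs f I) (applyComp I w)) Is
      S′ = concatMap (λ I → scaleP (prodCoeffs f′ I) (applyComp I w)) Is

-- The inner part (-t) ∘ log(1+t) ∘ (-t) is -log(1-t), and eᵗ∘(-log(1-t)) is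
-- computed by the chain rule.

module SeriesOfTheTheorem {c ℓ a} (F : Field c ℓ) (cz : CharZero F) {A : Set a} (ι : A ↣ ℕ)
                          (_⋄_ : A → A → List (Field.Carrier F × A)) where
  open Field F
  open Construction F ι _⋄_
  open PowerSeries commutativeRing
  open CharZeroField F cz
  open SR setoid
  open import Algebra.Properties.Ring ring using (-1*x≈-x; -‿distribˡ-*; -‿distribʳ-*; -‿involutive)
  open import Algebra.Properties.Semiring.Mult semiring using (×1-homo-*)

  signPow-sq : ∀ n → signPow n * signPow n ≈ 1#
  signPow-sq zero    = *-identityˡ 1#
  signPow-sq (suc n) = begin
    (- signPow n) * (- signPow n)  ≈⟨ sym (-‿distribˡ-* _ _) ⟩
    - (signPow n * - signPow n)    ≈⟨ -‿cong (sym (-‿distribʳ-* _ _)) ⟩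
    - - (signPow n * signPow n)    ≈⟨ -‿involutive _ ⟩
    signPow n * signPow n          ≈⟨ signPow-sq n ⟩
    1#                             ∎

  compose-minusTʳ : ∀ f k → compose f minusT (suc k) ≈ signPow (suc k) * f (suc k)
  compose-minusTʳ f k = signs k (shift f)
    where
    signs : ∀ k G → compWith minusT G (shift minusT) k ≈ signPow (suc k) * G k
    signs zero    G = refl
    signs (suc k) G = begin
      - 1# * compWith minusT (shift G) (shift minusT) k + compWith minusT G (λ _ → 0#) k
        ≈⟨ +-cong (*-congˡ (signs k (shift G))) (compWith-zeroG minusT G k) ⟩
      - 1# * (signPow (suc k) * G (suc k)) + 0#  ≈⟨ +-identityʳ _ ⟩
      - 1# * (signPow (suc k) * G (suc k))       ≈⟨ sym (*-assoc _ _ _) ⟩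
      (- 1# * signPow (suc k)) * G (suc k)       ≈⟨ *-congʳ (-1*x≈-x _) ⟩
      signPow (suc (suc k)) * G (suc k)          ∎

  compose-minusTˡ : ∀ h k → compose minusT h (suc k) ≈ - h (suc k)
  compose-minusTˡ h k = trans (compWith-const h (shift h) k (λ _ → refl)) (-1*x≈-x _)

  log∘minusT : ∀ k → compose logSeries minusT (suc k) ≈ - logGeometric (suc k)
  log∘minusT k = begin
    compose logSeries minusT (suc k)                      ≈⟨ compose-minusTʳ logSeries k ⟩
    (- s) * (s * logGeometric (suc k))                    ≈⟨ sym (-‿distribˡ-* _ _) ⟩
    - (s * (s * logGeometric (suc k)))                    ≈⟨ -‿cong (sym (*-assoc _ _ _)) ⟩
    - ((s * s) * logGeometric (suc k))                    ≈⟨ -‿cong (trans (*-congʳ (signPow-sq k)) (*-identityˡ _)) ⟩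
    - logGeometric (suc k)                                ∎
    where s = signPow k

  minusT∘log∘minusT : ∀ k → compose minusT (compose logSeries minusT) k ≈ logGeometric k
  minusT∘log∘minusT zero    = refl
  minusT∘log∘minusT (suc k) = begin
    compose minusT (compose logSeries minusT) (suc k)  ≈⟨ compose-minusTˡ (compose logSeries minusT) k ⟩
    - compose logSeries minusT (suc k)                 ≈⟨ -‿cong (log∘minusT k) ⟩
    - - logGeometric (suc k)                           ≈⟨ -‿involutive _ ⟩
    logGeometric (suc k)                               ∎

  -- eᵗ, including its constant term, satisfies D E = E
  expWithConstant : Seq
  expWithConstant zero    = 1#
  expWithConstant (suc n) = expSeries (suc n)

  natCast-* : ∀ m n → natCast F (m ℕ.* n) ≈ natCast F m * natCast F n
  natCast-* m n = trans (natCast≈N (m ℕ.* n)) (trans (×1-homo-* m n) (sym (*-cong (natCast≈N m) (natCast≈N n))))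

  factorial≉0 : ∀ n → ¬ (natCast F (factorial n) ≈ 0#)
  factorial≉0 zero    = cz 0
  factorial≉0 (suc n) = λ e → nonzero-* (cz n) (factorial≉0 n) (trans (sym (natCast-* (suc n) (factorial n))) e)

  D-exp : ∀ m → deriv expWithConstant m ≈ expWithConstant m
  D-exp zero    = trans (*-congʳ (sym (natCast≈N 1))) (⁻¹-inverse _ (cz 0))
  D-exp (suc m) = begin
    N (suc (suc m)) * natCast F (suc (suc m) ℕ.* factorial (suc m)) ⁻¹
      ≈⟨ *-cong (sym (natCast≈N (suc (suc m))))
                (⁻¹-cong (factorial≉0 (suc (suc m))) (nonzero-* x≉0 y≉0) (natCast-* (suc (suc m)) (factorial (suc m)))) ⟩
    x * (x * y) ⁻¹      ≈⟨ *-congˡ (⁻¹-* x≉0 y≉0) ⟩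
    x * (x ⁻¹ * y ⁻¹)   ≈⟨ sym (*-assoc _ _ _) ⟩
    (x * x ⁻¹) * y ⁻¹   ≈⟨ *-congʳ (⁻¹-inverse x x≉0) ⟩
    1# * y ⁻¹           ≈⟨ *-identityˡ _ ⟩
    y ⁻¹                ∎
    where
    x = natCast F (suc (suc m))
    y = natCast F (factorial (suc m))
    x≉0 = cz (suc m)
    y≉0 = factorial≉0 (suc m)

  exp∘minusT∘log∘minusT : ∀ k → compose expSeries (compose minusT (compose logSeries minusT)) k ≈ geomSeries k
  exp∘minusT∘log∘minusT zero    = refl
  exp∘minusT∘log∘minusT (suc k) = begin
    compose expSeries (compose minusT (compose logSeries minusT)) (suc k)
      ≈⟨ compose-cong {expSeries} (λ _ → refl) minusT∘log∘minusT (suc k) ⟩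
    compose expWithConstant logGeometric (suc k) ≈⟨ exp∘logGeometric expWithConstant refl D-exp (suc k) ⟩
    1#                                           ∎

theorem2 : ∀ {c ℓ a : Level} (F : Field c ℓ) → CharZero F →
           {A : Set a} (ι : A ↣ ℕ) (_⋄_ : A → A → List (Field.Carrier F × A)) →
           let open Construction F ι _⋄_ in
           Commutative⋄ → Associative⋄ →
           ∀ (p : Poly) → Σmap p ≈P expMap (T (logMap (T p)))
theorem2 F cz ι _⋄_ _ ⋄-assoc p = ∼⇒≈P {Σmap p} {expMap (T (logMap (T p)))} chain
  where
  open Field F
  open SR setoid
  open Construction F ι _⋄_
  open LinearCombinations commutativeRing using (ev)
  open PowerSeries commutativeRing using (compose)
  open Operators F ι _⋄_
  open SeriesOfTheTheorem F cz ι _⋄_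
  open module Comp (f g : ℕ → Carrier) = Composition ⋄-assoc f g using (Ψ-comp)

  log[1-t] -log[1-t] : ℕ → Carrier
  log[1-t]  = compose logSeries minusT
  -log[1-t] = compose minusT log[1-t]

  inside : ∀ f P Q → P ∼ Q → Ψ f P ∼ Ψ f Q
  inside f P Q = ∼-linExt (Ψword f) {P} {Q}

  chain : Σmap p ∼ expMap (T (logMap (T p)))
  chain G = begin
    ev G (Ψ geomSeries p)                          ≈⟨ Ψ-cong (λ k → sym (exp∘minusT∘log∘minusT k)) p G ⟩
    ev G (Ψ (compose expSeries -log[1-t]) p)       ≈⟨ sym (Ψ-comp expSeries -log[1-t] p G) ⟩
    ev G (Ψ expSeries (Ψ -log[1-t] p))
      ≈⟨ inside expSeries (Ψ -log[1-t] p) (Ψ minusT (Ψ log[1-t] p)) (λ H → sym (Ψ-comp minusT log[1-t] p H)) G ⟩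
    ev G (Ψ expSeries (Ψ minusT (Ψ log[1-t] p)))
      ≈⟨ inside expSeries (Ψ minusT (Ψ log[1-t] p)) (Ψ minusT (Ψ logSeries (Ψ minusT p)))
                (inside minusT (Ψ log[1-t] p) (Ψ logSeries (Ψ minusT p)) (λ H → sym (Ψ-comp logSeries minusT p H))) G ⟩
    ev G (Ψ expSeries (Ψ minusT (Ψ logSeries (Ψ minusT p)))) ∎
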